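{- In the HyLL sequent calculus (described in the context), the following rules are invertible, i.e. whenever the conclusion of an instance of the rule is derivable, every premise of that instance is derivable: (1) on the right: $\&$R, $\top$R, $\multimap$R, $\forall$R, $\downarrow$R and at R; (2) on the left: $\otimes$L, $\mathbf1$L, $\oplus$L, $\mathbf0$L, $\exists$L, !L, $\downarrow$L and at L.
   Context: Fix a constraint domain, i.e. a monoid $\mathcal W=\langle W,\cdot,\iota\rangle$ whose elements are called worlds. World expressions $u,v,w$ are built from world variables and elements of $W$ using $\cdot$; terms are built from term variables and function symbols. HyLL propositions are $A,B::= a\,\vec t \mid A\otimes B\mid \mathbf 1\mid A\multimap B\mid A\,\&\,B\mid\top\mid A\oplus B\mid \mathbf 0\mid\, !A\mid \forall x.A\mid\exists x.A\mid (A\ \mathrm{at}\ w)\mid \downarrow u.A\mid\forall u.A\mid \exists u.A$, with $a$ a predicate symbol applied to terms, $x$ a term variable, $u$ a world variable ($\downarrow u$, $\forall u$, $\exists u$ bind $u$). $\alpha$ ranges over variables of either kind, $\tau$ over terms or world expressions accordingly, $[\tau/\alpha]A$ is capture-avoiding substitution, and propositions are identified up to $\alpha$-conversion. A judgement is $A@w$. Sequents have the form $\Gamma;\Delta\Longrightarrow C@w$ with $\Gamma$ a set (unrestricted context) and $\Delta$ a multiset (linear context) of judgements. The derivable sequents are generated by the rules (premises $\Rightarrow$ conclusion): init: $\Gamma;a\,\vec t@u\Longrightarrow a\,\vec t@u$; copy: from $\Gamma,A@u;\Delta,A@u\Longrightarrow C@w$ infer $\Gamma,A@u;\Delta\Longrightarrow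 C@w$; $\otimes$R: from $\Gamma;\Delta\Longrightarrow A@w$ and $\Gamma;\Delta'\Longrightarrow B@w$ infer $\Gamma;\Delta,\Delta'\Longrightarrow A\otimes B@w$; $\otimes$L: from $\Gamma;\Delta,A@u,B@u\Longrightarrow C@w$ infer $\Gamma;\Delta,A\otimes B@u\Longrightarrow C@w$; $\mathbf1$R: $\Gamma;\cdot\Longrightarrow\mathbf1@w$; $\mathbf1$L: from $\Gamma;\Delta\Longrightarrow C@w$ infer $\Gamma;\Delta,\mathbf1@u\Longrightarrow C@w$; $\multimap$R: from $\Gamma;\Delta,A@w\Longrightarrow B@w$ infer $\Gamma;\Delta\Longrightarrow A\multimap B@w$; $\multimap$L: from $\Gamma;\Delta\Longrightarrow A@u$ and $\Gamma;\Delta',B@u\Longrightarrow C@w$ infer $\Gamma;\Delta,\Delta',A\multimap B@u\Longrightarrow C@w$; $\top$R: $\Gamma;\Delta\Longrightarrow\top@w$; $\&$R: from $\Gamma;\Delta\Longrightarrow A@w$ and $\Gamma;\Delta\Longrightarrow B@w$ infer $\Gamma;\Delta\Longrightarrow A\&B@w$; $\&$L$_i$: from $\Gamma;\Delta,A_i@u\Longrightarrow C@w$ infer $\Gamma;\Delta,A_1\&A_2@u\Longrightarrow C@w$; $\oplus$R$_i$: from $\Gamma;\Delta\Longrightarrow A_i@w$ infer $\Gamma;\Delta\Longrightarrow A_1\oplus A_2@w$; $\oplus$L: from $\Gamma;\Delta,A@u\Longrightarrow C@w$ and $\Gamma;\Delta,B@u\Longrightarrow C@w$ infer $\Gamma;\Delta,A\oplus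 B@u\Longrightarrow C@w$; $\mathbf0$L: $\Gamma;\Delta,\mathbf0@u\Longrightarrow C@w$; $\forall$R: from $\Gamma;\Delta\Longrightarrow A@w$ infer $\Gamma;\Delta\Longrightarrow\forall\alpha.A@w$ ($\alpha$ fresh for the conclusion); $\forall$L: from $\Gamma;\Delta,[\tau/\alpha]A@u\Longrightarrow C@w$ infer $\Gamma;\Delta,\forall\alpha.A@u\Longrightarrow C@w$; $\exists$R: from $\Gamma;\Delta\Longrightarrow[\tau/\alpha]A@w$ infer $\Gamma;\Delta\Longrightarrow\exists\alpha.A@w$; $\exists$L: from $\Gamma;\Delta,A@u\Longrightarrow C@w$ infer $\Gamma;\Delta,\exists\alpha.A@u\Longrightarrow C@w$ ($\alpha$ fresh for the conclusion); !R: from $\Gamma;\cdot\Longrightarrow A@w$ infer $\Gamma;\cdot\Longrightarrow !A@w$; !L: from $\Gamma,A@u;\Delta\Longrightarrow C@w$ infer $\Gamma;\Delta,!A@u\Longrightarrow C@w$; at R: from $\Gamma;\Delta\Longrightarrow A@u$ infer $\Gamma;\Delta\Longrightarrow(A\ \mathrm{at}\ u)@v$; at L: from $\Gamma;\Delta,A@u\Longrightarrow C@w$ infer $\Gamma;\Delta,(A\ \mathrm{at}\ u)@v\Longrightarrow C@w$; $\downarrow$R: from $\Gamma;\Delta\Longrightarrow[w/u]A@w$ infer $\Gamma;\Delta\Longrightarrow\downarrow u.A@w$; $\downarrow$L: from $\Gamma;\Delta,[v/u]A@v\Longrightarrow C@w$ infer $\Gamma;\Delta,\downarrow u.A@v\Longrightarrow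 C@w$. -}

module Defs where

open import Level using (Level; _⊔_) renaming (suc to lsuc)
open import Algebra.Bundles using (Monoid)
open import Data.Nat using (ℕ; zero; suc)
open import Data.Fin using (Fin; zero; suc)
open import Data.Vec using (Vec; []; _∷_)
open import Data.List using (List; []; _∷_; _++_; [_]; map)
open import Data.List.Membership.Propositional using (_∈_)
open import Data.List.Relation.Binary.Permutation.Propositional using (_↭_)
open import Data.Product using (_×_; _,_)
open import Data.Unit.Polymorphic using (⊤)

record Signature : Set₁ where
  field
    FunSym    : Set
    funArity  : FunSym → ℕ
    PredSym   : Set
    predArity : PredSym → ℕ

-- Variables are de Bruijn indices of two sorts; a syntactic object of
-- scope (m , k) has m term variables and k world variables in scope.
-- This realises identification up to α-conversion.
module HyLL {c ℓ : Level} (𝒲 : Monoid c ℓ) (Sig : Signature) where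
  open Signature Sig
  open Monoid 𝒲 using (Carrier)

  data Term (m : ℕ) : Set where
    var : Fin m → Term m
    fun : (f : FunSym) → Vec (Term m) (funArity f) → Term m

  mutual
    substT : ∀ {m m'} → (Fin m → Term m') → Term m → Term m'
    substT σ (var i)    = σ i
    substT σ (fun f ts) = fun f (substTs σ ts)

    substTs : ∀ {m m' n} → (Fin m → Term m') → Vec (Term m) n → Vec (Term m') n
    substTs σ []       = []
    substTs σ (t ∷ ts) = substT σ t ∷ substTs σ ts

  data World (k : ℕ) : Set c where
    wvar : Fin k → World k
    wel  : Carrier → World k
    _·_  : World k → World k → World k

  substW : ∀ {k k'} → (Fin k → World k') → World k → World k'
  substW ρ (wvar i) = ρ i
  substW ρ (wel a)  = wel a
  substW ρ (u · v)  = substW ρ u · substW ρ v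

  infixr 6 _⊗_ _&_ _⊕_
  infixr 5 _⊸_
  data Prop (m k : ℕ) : Set c where
    atom : (p : PredSym) → Vec (Term m) (predArity p) → Prop m k
    _⊗_  : Prop m k → Prop m k → Prop m k
    `𝟏   : Prop m k
    _⊸_  : Prop m k → Prop m k → Prop m k
    _&_  : Prop m k → Prop m k → Prop m k
    `⊤   : Prop m k
    _⊕_  : Prop m k → Prop m k → Prop m k
    `𝟎   : Prop m k
    `!   : Prop m k → Prop m k
    `∀t  : Prop (suc m) k → Prop m k
    `∃t  : Prop (suc m) k → Prop m k
    _at_ : Prop m k → World k → Prop m k
    `↓   : Prop m (suc k) → Prop m k
    `∀w  : Prop m (suc k) → Prop m k
    `∃w  : Prop m (suc k) → Prop m k

  liftT : ∀ {m m'} → (Fin m → Term m') → Fin (suc m) → Term (suc m')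
  liftT σ zero    = var zero
  liftT σ (suc i) = substT (λ j → var (suc j)) (σ i)

  liftW : ∀ {k k'} → (Fin k → World k') → Fin (suc k) → World (suc k')
  liftW ρ zero    = wvar zero
  liftW ρ (suc i) = substW (λ j → wvar (suc j)) (ρ i)

  substPT : ∀ {m m' k} → (Fin m → Term m') → Prop m k → Prop m' k
  substPT σ (atom p ts) = atom p (substTs σ ts)
  substPT σ (A ⊗ B)  = substPT σ A ⊗ substPT σ B
  substPT σ `𝟏       = `𝟏
  substPT σ (A ⊸ B)  = substPT σ A ⊸ substPT σ B
  substPT σ (A & B)  = substPT σ A & substPT σ B
  substPT σ `⊤       = `⊤
  substPT σ (A ⊕ B)  = substPT σ A ⊕ substPT σ B
  substPT σ `𝟎       = `𝟎
  substPT σ (`! A)   = `! (substPT σ A)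
  substPT σ (`∀t A)  = `∀t (substPT (liftT σ) A)
  substPT σ (`∃t A)  = `∃t (substPT (liftT σ) A)
  substPT σ (A at u) = substPT σ A at u
  substPT σ (`↓ A)   = `↓ (substPT σ A)
  substPT σ (`∀w A)  = `∀w (substPT σ A)
  substPT σ (`∃w A)  = `∃w (substPT σ A)

  substPW : ∀ {m k k'} → (Fin k → World k') → Prop m k → Prop m k'
  substPW ρ (atom p ts) = atom p ts
  substPW ρ (A ⊗ B)  = substPW ρ A ⊗ substPW ρ B
  substPW ρ `𝟏       = `𝟏
  substPW ρ (A ⊸ B)  = substPW ρ A ⊸ substPW ρ B
  substPW ρ (A & B)  = substPW ρ A & substPW ρ B
  substPW ρ `⊤       = `⊤
  substPW ρ (A ⊕ B)  = substPW ρ A ⊕ substPW ρ B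
  substPW ρ `𝟎       = `𝟎
  substPW ρ (`! A)   = `! (substPW ρ A)
  substPW ρ (`∀t A)  = `∀t (substPW ρ A)
  substPW ρ (`∃t A)  = `∃t (substPW ρ A)
  substPW ρ (A at u) = substPW ρ A at substW ρ u
  substPW ρ (`↓ A)   = `↓ (substPW (liftW ρ) A)
  substPW ρ (`∀w A)  = `∀w (substPW (liftW ρ) A)
  substPW ρ (`∃w A)  = `∃w (substPW (liftW ρ) A)

  sub1T : ∀ {m} → Term m → Fin (suc m) → Term m
  sub1T t zero    = t
  sub1T t (suc i) = var i

  sub1W : ∀ {k} → World k → Fin (suc k) → World k
  sub1W w zero    = w
  sub1W w (suc i) = wvar i

  [_/x]_ : ∀ {m k} → Term m → Prop (suc m) k → Prop m k
  [ t /x] A = substPT (sub1T t) A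

  [_/u]_ : ∀ {m k} → World k → Prop m (suc k) → Prop m k
  [ w /u] A = substPW (sub1W w) A

  infix 4 _＠_
  data Jdg (m k : ℕ) : Set c where
    _＠_ : Prop m k → World k → Jdg m k

  ↑W : ∀ {k} → World k → World (suc k)
  ↑W = substW (λ j → wvar (suc j))

  ↑tJ : ∀ {m k} → Jdg m k → Jdg (suc m) k
  ↑tJ (A ＠ w) = substPT (λ j → var (suc j)) A ＠ w

  ↑wJ : ∀ {m k} → Jdg m k → Jdg m (suc k)
  ↑wJ (A ＠ w) = substPW (λ j → wvar (suc j)) A ＠ ↑W w

  ↑t* : ∀ {m k} → List (Jdg m k) → List (Jdg (suc m) k)
  ↑t* = map ↑tJ

  ↑w* : ∀ {m k} → List (Jdg m k) → List (Jdg m (suc k))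
  ↑w* = map ↑wJ

  -- Sequents Γ ; Δ ⟹ C @ w.  Γ is a set, represented by a list (only
  -- membership and extension are used); Δ is a multiset, represented by a
  -- list, every left rule / splitting rule matches Δ up to permutation (↭).
  infix 3 _⨾_⟹_
  data _⨾_⟹_ {m k : ℕ} (Γ : List (Jdg m k)) : List (Jdg m k) → Jdg m k → Set c where
    init : ∀ {p ts u} → Γ ⨾ [ atom p ts ＠ u ] ⟹ atom p ts ＠ u
    copy : ∀ {Δ A u J} → (A ＠ u) ∈ Γ → Γ ⨾ (A ＠ u) ∷ Δ ⟹ J → Γ ⨾ Δ ⟹ J
    ⊗R : ∀ {Δ Δ₁ Δ₂ A B w} → Δ ↭ Δ₁ ++ Δ₂ →
         Γ ⨾ Δ₁ ⟹ A ＠ w → Γ ⨾ Δ₂ ⟹ B ＠ w → Γ ⨾ Δ ⟹ A ⊗ B ＠ w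
    ⊗L : ∀ {Δ Δ₀ A B u J} → Δ ↭ (A ⊗ B ＠ u) ∷ Δ₀ →
         Γ ⨾ (A ＠ u) ∷ (B ＠ u) ∷ Δ₀ ⟹ J → Γ ⨾ Δ ⟹ J
    𝟏R : ∀ {w} → Γ ⨾ [] ⟹ `𝟏 ＠ w
    𝟏L : ∀ {Δ Δ₀ u J} → Δ ↭ (`𝟏 ＠ u) ∷ Δ₀ → Γ ⨾ Δ₀ ⟹ J → Γ ⨾ Δ ⟹ J
    ⊸R : ∀ {Δ A B w} → Γ ⨾ (A ＠ w) ∷ Δ ⟹ B ＠ w → Γ ⨾ Δ ⟹ A ⊸ B ＠ w
    ⊸L : ∀ {Δ Δ₁ Δ₂ A B u J} → Δ ↭ (A ⊸ B ＠ u) ∷ (Δ₁ ++ Δ₂) →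
         Γ ⨾ Δ₁ ⟹ A ＠ u → Γ ⨾ (B ＠ u) ∷ Δ₂ ⟹ J → Γ ⨾ Δ ⟹ J
    ⊤R : ∀ {Δ w} → Γ ⨾ Δ ⟹ `⊤ ＠ w
    &R : ∀ {Δ A B w} → Γ ⨾ Δ ⟹ A ＠ w → Γ ⨾ Δ ⟹ B ＠ w → Γ ⨾ Δ ⟹ A & B ＠ w
    &L₁ : ∀ {Δ Δ₀ A B u J} → Δ ↭ (A & B ＠ u) ∷ Δ₀ →
          Γ ⨾ (A ＠ u) ∷ Δ₀ ⟹ J → Γ ⨾ Δ ⟹ J
    &L₂ : ∀ {Δ Δ₀ A B u J} → Δ ↭ (A & B ＠ u) ∷ Δ₀ →
          Γ ⨾ (B ＠ u) ∷ Δ₀ ⟹ J → Γ ⨾ Δ ⟹ J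
    ⊕R₁ : ∀ {Δ A B w} → Γ ⨾ Δ ⟹ A ＠ w → Γ ⨾ Δ ⟹ A ⊕ B ＠ w
    ⊕R₂ : ∀ {Δ A B w} → Γ ⨾ Δ ⟹ B ＠ w → Γ ⨾ Δ ⟹ A ⊕ B ＠ w
    ⊕L : ∀ {Δ Δ₀ A B u J} → Δ ↭ (A ⊕ B ＠ u) ∷ Δ₀ →
         Γ ⨾ (A ＠ u) ∷ Δ₀ ⟹ J → Γ ⨾ (B ＠ u) ∷ Δ₀ ⟹ J → Γ ⨾ Δ ⟹ J
    𝟎L : ∀ {Δ Δ₀ u J} → Δ ↭ (`𝟎 ＠ u) ∷ Δ₀ → Γ ⨾ Δ ⟹ J
    -- ∀R / ∃L: the bound variable becomes a fresh variable (de Bruijn 0),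
    -- everything else in the sequent is weakened.
    ∀tR : ∀ {Δ A w} → ↑t* Γ ⨾ ↑t* Δ ⟹ A ＠ w → Γ ⨾ Δ ⟹ `∀t A ＠ w
    ∀wR : ∀ {Δ A w} → ↑w* Γ ⨾ ↑w* Δ ⟹ A ＠ ↑W w → Γ ⨾ Δ ⟹ `∀w A ＠ w
    ∀tL : ∀ {Δ Δ₀ A u J} (t : Term m) → Δ ↭ (`∀t A ＠ u) ∷ Δ₀ →
          Γ ⨾ ([ t /x] A ＠ u) ∷ Δ₀ ⟹ J → Γ ⨾ Δ ⟹ J
    ∀wL : ∀ {Δ Δ₀ A u J} (v : World k) → Δ ↭ (`∀w A ＠ u) ∷ Δ₀ →
          Γ ⨾ ([ v /u] A ＠ u) ∷ Δ₀ ⟹ J → Γ ⨾ Δ ⟹ J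
    ∃tR : ∀ {Δ A w} (t : Term m) → Γ ⨾ Δ ⟹ [ t /x] A ＠ w → Γ ⨾ Δ ⟹ `∃t A ＠ w
    ∃wR : ∀ {Δ A w} (v : World k) → Γ ⨾ Δ ⟹ [ v /u] A ＠ w → Γ ⨾ Δ ⟹ `∃w A ＠ w
    ∃tL : ∀ {Δ Δ₀ A u J} → Δ ↭ (`∃t A ＠ u) ∷ Δ₀ →
          ↑t* Γ ⨾ (A ＠ u) ∷ ↑t* Δ₀ ⟹ ↑tJ J → Γ ⨾ Δ ⟹ J
    ∃wL : ∀ {Δ Δ₀ A u J} → Δ ↭ (`∃w A ＠ u) ∷ Δ₀ →
          ↑w* Γ ⨾ (A ＠ ↑W u) ∷ ↑w* Δ₀ ⟹ ↑wJ J → Γ ⨾ Δ ⟹ J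
    !R : ∀ {A w} → Γ ⨾ [] ⟹ A ＠ w → Γ ⨾ [] ⟹ `! A ＠ w
    !L : ∀ {Δ Δ₀ A u J} → Δ ↭ (`! A ＠ u) ∷ Δ₀ →
         (A ＠ u) ∷ Γ ⨾ Δ₀ ⟹ J → Γ ⨾ Δ ⟹ J
    atR : ∀ {Δ A u v} → Γ ⨾ Δ ⟹ A ＠ u → Γ ⨾ Δ ⟹ (A at u) ＠ v
    atL : ∀ {Δ Δ₀ A u v J} → Δ ↭ ((A at u) ＠ v) ∷ Δ₀ →
          Γ ⨾ (A ＠ u) ∷ Δ₀ ⟹ J → Γ ⨾ Δ ⟹ J
    ↓R : ∀ {Δ A w} → Γ ⨾ Δ ⟹ [ w /u] A ＠ w → Γ ⨾ Δ ⟹ `↓ A ＠ w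
    ↓L : ∀ {Δ Δ₀ A v J} → Δ ↭ (`↓ A ＠ v) ∷ Δ₀ →
         Γ ⨾ ([ v /u] A ＠ v) ∷ Δ₀ ⟹ J → Γ ⨾ Δ ⟹ J

  -- Invertibility of each rule: derivability of the conclusion of any
  -- instance implies derivability of every premise of that instance.
  -- (Δ is a multiset, so the principal formula is placed at the head.)

  Inv-&R : Set c
  Inv-&R = ∀ {m k} (Γ Δ : List (Jdg m k)) (A B : Prop m k) (w : World k) →
    Γ ⨾ Δ ⟹ A & B ＠ w → (Γ ⨾ Δ ⟹ A ＠ w) × (Γ ⨾ Δ ⟹ B ＠ w)

  -- ⊤R has no premises: invertibility is vacuous
  Inv-⊤R : Set c
  Inv-⊤R = ∀ {m k} (Γ Δ : List (Jdg m k)) (w : World k) →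
    Γ ⨾ Δ ⟹ `⊤ ＠ w → ⊤ {c}

  Inv-⊸R : Set c
  Inv-⊸R = ∀ {m k} (Γ Δ : List (Jdg m k)) (A B : Prop m k) (w : World k) →
    Γ ⨾ Δ ⟹ A ⊸ B ＠ w → Γ ⨾ (A ＠ w) ∷ Δ ⟹ B ＠ w

  Inv-∀tR : Set c
  Inv-∀tR = ∀ {m k} (Γ Δ : List (Jdg m k)) (A : Prop (suc m) k) (w : World k) →
    Γ ⨾ Δ ⟹ `∀t A ＠ w → ↑t* Γ ⨾ ↑t* Δ ⟹ A ＠ w

  Inv-∀wR : Set c
  Inv-∀wR = ∀ {m k} (Γ Δ : List (Jdg m k)) (A : Prop m (suc k)) (w : World k) →
    Γ ⨾ Δ ⟹ `∀w A ＠ w → ↑w* Γ ⨾ ↑w* Δ ⟹ A ＠ ↑W w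

  Inv-↓R : Set c
  Inv-↓R = ∀ {m k} (Γ Δ : List (Jdg m k)) (A : Prop m (suc k)) (w : World k) →
    Γ ⨾ Δ ⟹ `↓ A ＠ w → Γ ⨾ Δ ⟹ [ w /u] A ＠ w

  Inv-atR : Set c
  Inv-atR = ∀ {m k} (Γ Δ : List (Jdg m k)) (A : Prop m k) (u v : World k) →
    Γ ⨾ Δ ⟹ (A at u) ＠ v → Γ ⨾ Δ ⟹ A ＠ u

  Inv-⊗L : Set c
  Inv-⊗L = ∀ {m k} (Γ Δ : List (Jdg m k)) (A B : Prop m k) (u : World k) (J : Jdg m k) →
    Γ ⨾ (A ⊗ B ＠ u) ∷ Δ ⟹ J → Γ ⨾ (A ＠ u) ∷ (B ＠ u) ∷ Δ ⟹ J

  Inv-𝟏L : Set c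
  Inv-𝟏L = ∀ {m k} (Γ Δ : List (Jdg m k)) (u : World k) (J : Jdg m k) →
    Γ ⨾ (`𝟏 ＠ u) ∷ Δ ⟹ J → Γ ⨾ Δ ⟹ J

  Inv-⊕L : Set c
  Inv-⊕L = ∀ {m k} (Γ Δ : List (Jdg m k)) (A B : Prop m k) (u : World k) (J : Jdg m k) →
    Γ ⨾ (A ⊕ B ＠ u) ∷ Δ ⟹ J →
    (Γ ⨾ (A ＠ u) ∷ Δ ⟹ J) × (Γ ⨾ (B ＠ u) ∷ Δ ⟹ J)

  -- 𝟎L has no premises: invertibility is vacuous
  Inv-𝟎L : Set c
  Inv-𝟎L = ∀ {m k} (Γ Δ : List (Jdg m k)) (u : World k) (J : Jdg m k) →
    Γ ⨾ (`𝟎 ＠ u) ∷ Δ ⟹ J → ⊤ {c}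

  Inv-∃tL : Set c
  Inv-∃tL = ∀ {m k} (Γ Δ : List (Jdg m k)) (A : Prop (suc m) k) (u : World k) (J : Jdg m k) →
    Γ ⨾ (`∃t A ＠ u) ∷ Δ ⟹ J → ↑t* Γ ⨾ (A ＠ u) ∷ ↑t* Δ ⟹ ↑tJ J

  Inv-∃wL : Set c
  Inv-∃wL = ∀ {m k} (Γ Δ : List (Jdg m k)) (A : Prop m (suc k)) (u : World k) (J : Jdg m k) →
    Γ ⨾ (`∃w A ＠ u) ∷ Δ ⟹ J → ↑w* Γ ⨾ (A ＠ ↑W u) ∷ ↑w* Δ ⟹ ↑wJ J

  Inv-!L : Set c
  Inv-!L = ∀ {m k} (Γ Δ : List (Jdg m k)) (A : Prop m k) (u : World k) (J : Jdg m k) →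
    Γ ⨾ (`! A ＠ u) ∷ Δ ⟹ J → (A ＠ u) ∷ Γ ⨾ Δ ⟹ J

  Inv-↓L : Set c
  Inv-↓L = ∀ {m k} (Γ Δ : List (Jdg m k)) (A : Prop m (suc k)) (v : World k) (J : Jdg m k) →
    Γ ⨾ (`↓ A ＠ v) ∷ Δ ⟹ J → Γ ⨾ ([ v /u] A ＠ v) ∷ Δ ⟹ J

  Inv-atL : Set c
  Inv-atL = ∀ {m k} (Γ Δ : List (Jdg m k)) (A : Prop m k) (u v : World k) (J : Jdg m k) →
    Γ ⨾ ((A at u) ＠ v) ∷ Δ ⟹ J → Γ ⨾ (A ＠ u) ∷ Δ ⟹ J

  Theorem6 : Set c
  Theorem6 =
    (Inv-&R × Inv-⊤R × Inv-⊸R × Inv-∀tR × Inv-∀wR × Inv-↓R × Inv-atR) ×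
    (Inv-⊗L × Inv-𝟏L × Inv-⊕L × Inv-𝟎L × Inv-∃tL × Inv-∃wL × Inv-!L × Inv-↓L × Inv-atL)

module Submission where

-- Each case is an instance of one of two lemmas proved by induction on
-- derivations.  For right rules (invertR) the last rule is either the right
-- rule of the step, whose premise is the goal, or copy or a left rule, which
-- commutes with the inversion.  For left rules (invertL) the principal
-- judgement is tracked through the linear context up to permutation: it is
-- either principal in the last rule, whose premise is the goal, or that rule
-- commutes with the inversion.  Passing under ∀R and ∃L changes the variable
-- scope, so the quantifier steps invert to an arbitrary instance [τ/α]A,
-- which is stable under weakening; the stated premise is then obtained by
-- weakening the derivation and instantiating at the fresh variable, using
-- admissibility of substitution in derivations.

open import Defs
open import Level using (Level)
open import Algebra.Bundles using (Monoid)
open import Data.Nat using (suc)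
open import Data.Fin using (Fin; zero; suc)
open import Data.Vec using (Vec; []; _∷_)
open import Data.List using (List; []; _∷_; _++_; [_]; map)
open import Data.List.Properties using (map-++; map-∘; map-cong; map-id; ++-assoc)
open import Data.List.Membership.Propositional using (_∈_)
open import Data.List.Membership.Propositional.Properties
  using (∈-map⁺; ∈-map⁻; ∈-++⁺ʳ; ∈-++⁻; ∈-∃++)
open import Data.List.Relation.Unary.Any using (here; there)
open import Data.List.Relation.Binary.Permutation.Propositional
  using (_↭_; prep; swap; ↭-refl; ↭-sym; ↭-trans; ↭-reflexive)
open import Data.List.Relation.Binary.Permutation.Propositional.Properties
  using (map⁺; ↭-empty-inv; ↭-singleton-inv; ¬x∷xs↭[]; ∈-resp-↭; drop-∷; shift; shifts; ++⁺ˡ)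
open import Data.Product using (_×_; _,_; Σ)
open import Data.Sum using (_⊎_; inj₁; inj₂)
open import Data.Empty using (⊥-elim)
open import Data.Unit.Polymorphic using (tt)
open import Function using (_∘_)
open import Relation.Binary.PropositionalEquality
  using (_≡_; refl; sym; trans; cong; cong₂; _≗_; module ≡-Reasoning)

-- Linear contexts are multisets,
-- represented by lists up to _↭_, so the proofs below constantly have to
-- locate a judgement inside a permuted context and move it to the front.
module ListFacts {a} {A : Set a} where

  map-square : ∀ {b c d} {B : Set b} {C : Set c} {D : Set d}
    {f : B → D} {g : A → B} {h : C → D} {k : A → C} →
    (∀ x → f (g x) ≡ h (k x)) → ∀ xs → map f (map g xs) ≡ map h (map k xs)
  map-square e xs = trans (sym (map-∘ xs)) (trans (map-cong e xs) (map-∘ xs))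

  map-cancel : ∀ {b} {B : Set b} {f : B → A} {g : A → B} →
    (∀ x → f (g x) ≡ x) → ∀ xs → map f (map g xs) ≡ xs
  map-cancel e xs = trans (sym (map-∘ xs)) (trans (map-cong e xs) (map-id xs))

  map⁺-++ : ∀ {b} {B : Set b} (f : A → B) {Δ : List A} Δ₁ Δ₂ →
    Δ ↭ Δ₁ ++ Δ₂ → map f Δ ↭ map f Δ₁ ++ map f Δ₂
  map⁺-++ f Δ₁ Δ₂ p = ↭-trans (map⁺ f p) (↭-reflexive (map-++ f Δ₁ Δ₂))

  map⁺-∷++ : ∀ {b} {B : Set b} (f : A → B) {Δ : List A} x Δ₁ Δ₂ →
    Δ ↭ x ∷ (Δ₁ ++ Δ₂) → map f Δ ↭ f x ∷ (map f Δ₁ ++ map f Δ₂)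
  map⁺-∷++ f x Δ₁ Δ₂ p = ↭-trans (map⁺ f p) (↭-reflexive (cong (f x ∷_) (map-++ f Δ₁ Δ₂)))

  ↭-∷-cases : ∀ {x y : A} {xs ys} → x ∷ xs ↭ y ∷ ys →
    (x ≡ y × xs ↭ ys) ⊎ Σ (List A) (λ zs → (ys ↭ x ∷ zs) × (xs ↭ y ∷ zs))
  ↭-∷-cases {x} {y} {xs} {ys} p with ∈-resp-↭ p (here refl)
  ... | here refl = inj₁ (refl , drop-∷ p)
  ... | there x∈ys with ∈-∃++ x∈ys
  ...   | as , bs , refl = inj₂ (as ++ bs , shift x as bs ,
          drop-∷ (↭-trans p (↭-trans (prep y (shift x as bs)) (swap y x ↭-refl))))

  ↭-++-cases : ∀ {x : A} {xs} ys zs → x ∷ xs ↭ ys ++ zs →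
    Σ (List A) (λ R → (ys ↭ x ∷ R) × (xs ↭ R ++ zs)) ⊎
    Σ (List A) (λ R → (zs ↭ x ∷ R) × (xs ↭ ys ++ R))
  ↭-++-cases {x} ys zs p with ∈-++⁻ ys (∈-resp-↭ p (here refl))
  ... | inj₁ x∈ys with ∈-∃++ x∈ys
  ...   | as , bs , refl = inj₁ (as ++ bs , shift x as bs ,
          drop-∷ (↭-trans p (↭-trans (↭-reflexive (++-assoc as (x ∷ bs) zs))
            (↭-trans (shift x as (bs ++ zs)) (prep x (↭-reflexive (sym (++-assoc as bs zs))))))))
  ↭-++-cases {x} ys zs p | inj₂ x∈zs with ∈-∃++ x∈zs
  ...   | as , bs , refl = inj₂ (as ++ bs , shift x as bs ,
          drop-∷ (↭-trans p (↭-trans (++⁺ˡ ys (shift x as bs)) (shift x ys (as ++ bs)))))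

  ↭-prefix : ∀ L {Δ} {x : A} {R} → Δ ↭ x ∷ R → L ++ Δ ↭ x ∷ (L ++ R)
  ↭-prefix L {x = x} {R} p = ↭-trans (++⁺ˡ L p) (shift x L R)

  shift₂ : ∀ L {x y : A} {R} → L ++ x ∷ y ∷ R ↭ x ∷ y ∷ (L ++ R)
  shift₂ L {x} {y} {R} = ↭-trans (shift x L (y ∷ R)) (prep x (shift y L R))

  ↭-under₁ : ∀ {z x : A} {Δ R} → Δ ↭ x ∷ R → z ∷ Δ ↭ x ∷ z ∷ R
  ↭-under₁ {z} {x} p = ↭-trans (prep z p) (swap z x ↭-refl)

  ↭-under₂ : ∀ {z w x : A} {Δ R} → Δ ↭ x ∷ R → z ∷ w ∷ Δ ↭ x ∷ z ∷ w ∷ R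
  ↭-under₂ {z} {w} {x} p = ↭-trans (prep z (prep w p)) (shift x (z ∷ w ∷ []) _)

open ListFacts

module Substitution {c ℓ : Level} (𝒲 : Monoid c ℓ) (Sig : Signature) where
  open HyLL 𝒲 Sig

  mutual
    substT-cong : ∀ {m m'} {σ τ : Fin m → Term m'} → σ ≗ τ → substT σ ≗ substT τ
    substT-cong e (var i)    = e i
    substT-cong e (fun f ts) = cong (fun f) (substTs-cong e ts)

    substTs-cong : ∀ {m m' n} {σ τ : Fin m → Term m'} → σ ≗ τ →
      (ts : Vec (Term m) n) → substTs σ ts ≡ substTs τ ts
    substTs-cong e []       = refl
    substTs-cong e (t ∷ ts) = cong₂ _∷_ (substT-cong e t) (substTs-cong e ts)

  mutual
    substT-fuse : ∀ {m m' m''} (σ : Fin m' → Term m'') (τ : Fin m → Term m') t →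
      substT σ (substT τ t) ≡ substT (substT σ ∘ τ) t
    substT-fuse σ τ (var i)    = refl
    substT-fuse σ τ (fun f ts) = cong (fun f) (substTs-fuse σ τ ts)

    substTs-fuse : ∀ {m m' m'' n} (σ : Fin m' → Term m'') (τ : Fin m → Term m')
      (ts : Vec (Term m) n) → substTs σ (substTs τ ts) ≡ substTs (substT σ ∘ τ) ts
    substTs-fuse σ τ []       = refl
    substTs-fuse σ τ (t ∷ ts) = cong₂ _∷_ (substT-fuse σ τ t) (substTs-fuse σ τ ts)

  mutual
    substT-id : ∀ {m} (t : Term m) → substT var t ≡ t
    substT-id (var i)    = refl
    substT-id (fun f ts) = cong (fun f) (substTs-id ts)

    substTs-id : ∀ {m n} (ts : Vec (Term m) n) → substTs var ts ≡ ts
    substTs-id []       = refl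
    substTs-id (t ∷ ts) = cong₂ _∷_ (substT-id t) (substTs-id ts)

  substW-cong : ∀ {k k'} {σ τ : Fin k → World k'} → σ ≗ τ → substW σ ≗ substW τ
  substW-cong e (wvar i) = e i
  substW-cong e (wel a)  = refl
  substW-cong e (u · v)  = cong₂ _·_ (substW-cong e u) (substW-cong e v)

  substW-fuse : ∀ {k k' k''} (σ : Fin k' → World k'') (τ : Fin k → World k') w →
    substW σ (substW τ w) ≡ substW (substW σ ∘ τ) w
  substW-fuse σ τ (wvar i) = refl
  substW-fuse σ τ (wel a)  = refl
  substW-fuse σ τ (u · v)  = cong₂ _·_ (substW-fuse σ τ u) (substW-fuse σ τ v)

  substW-id : ∀ {k} (w : World k) → substW wvar w ≡ w
  substW-id (wvar i) = refl
  substW-id (wel a)  = refl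
  substW-id (u · v)  = cong₂ _·_ (substW-id u) (substW-id v)

  liftT-cong : ∀ {m m'} {σ τ : Fin m → Term m'} → σ ≗ τ → liftT σ ≗ liftT τ
  liftT-cong e zero    = refl
  liftT-cong e (suc i) = cong (substT (λ j → var (suc j))) (e i)

  liftW-cong : ∀ {k k'} {σ τ : Fin k → World k'} → σ ≗ τ → liftW σ ≗ liftW τ
  liftW-cong e zero    = refl
  liftW-cong e (suc i) = cong (substW (λ j → wvar (suc j))) (e i)

  liftT-fuse : ∀ {m m' m''} (σ : Fin m' → Term m'') (τ : Fin m → Term m') →
    substT (liftT σ) ∘ liftT τ ≗ liftT (substT σ ∘ τ)
  liftT-fuse σ τ zero    = refl
  liftT-fuse σ τ (suc i) = trans (substT-fuse (liftT σ) _ (τ i)) (sym (substT-fuse _ σ (τ i)))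

  liftW-fuse : ∀ {k k' k''} (σ : Fin k' → World k'') (τ : Fin k → World k') →
    substW (liftW σ) ∘ liftW τ ≗ liftW (substW σ ∘ τ)
  liftW-fuse σ τ zero    = refl
  liftW-fuse σ τ (suc i) = trans (substW-fuse (liftW σ) _ (τ i)) (sym (substW-fuse _ σ (τ i)))

  liftT-id : ∀ {m} → liftT {m} var ≗ var
  liftT-id zero    = refl
  liftT-id (suc i) = refl

  liftW-id : ∀ {k} → liftW {k} wvar ≗ wvar
  liftW-id zero    = refl
  liftW-id (suc i) = refl

  substPT-cong : ∀ {m m' k} {σ τ : Fin m → Term m'} → σ ≗ τ →
    (A : Prop m k) → substPT σ A ≡ substPT τ A
  substPT-cong e (atom p ts) = cong (atom p) (substTs-cong e ts)
  substPT-cong e (A ⊗ B)  = cong₂ _⊗_ (substPT-cong e A) (substPT-cong e B)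
  substPT-cong e `𝟏       = refl
  substPT-cong e (A ⊸ B)  = cong₂ _⊸_ (substPT-cong e A) (substPT-cong e B)
  substPT-cong e (A & B)  = cong₂ _&_ (substPT-cong e A) (substPT-cong e B)
  substPT-cong e `⊤       = refl
  substPT-cong e (A ⊕ B)  = cong₂ _⊕_ (substPT-cong e A) (substPT-cong e B)
  substPT-cong e `𝟎       = refl
  substPT-cong e (`! A)   = cong `! (substPT-cong e A)
  substPT-cong e (`∀t A)  = cong `∀t (substPT-cong (liftT-cong e) A)
  substPT-cong e (`∃t A)  = cong `∃t (substPT-cong (liftT-cong e) A)
  substPT-cong e (A at u) = cong (_at u) (substPT-cong e A)
  substPT-cong e (`↓ A)   = cong `↓ (substPT-cong e A)
  substPT-cong e (`∀w A)  = cong `∀w (substPT-cong e A)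
  substPT-cong e (`∃w A)  = cong `∃w (substPT-cong e A)

  substPW-cong : ∀ {m k k'} {σ τ : Fin k → World k'} → σ ≗ τ →
    (A : Prop m k) → substPW σ A ≡ substPW τ A
  substPW-cong e (atom p ts) = refl
  substPW-cong e (A ⊗ B)  = cong₂ _⊗_ (substPW-cong e A) (substPW-cong e B)
  substPW-cong e `𝟏       = refl
  substPW-cong e (A ⊸ B)  = cong₂ _⊸_ (substPW-cong e A) (substPW-cong e B)
  substPW-cong e (A & B)  = cong₂ _&_ (substPW-cong e A) (substPW-cong e B)
  substPW-cong e `⊤       = refl
  substPW-cong e (A ⊕ B)  = cong₂ _⊕_ (substPW-cong e A) (substPW-cong e B)
  substPW-cong e `𝟎       = refl
  substPW-cong e (`! A)   = cong `! (substPW-cong e A)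
  substPW-cong e (`∀t A)  = cong `∀t (substPW-cong e A)
  substPW-cong e (`∃t A)  = cong `∃t (substPW-cong e A)
  substPW-cong e (A at u) = cong₂ _at_ (substPW-cong e A) (substW-cong e u)
  substPW-cong e (`↓ A)   = cong `↓ (substPW-cong (liftW-cong e) A)
  substPW-cong e (`∀w A)  = cong `∀w (substPW-cong (liftW-cong e) A)
  substPW-cong e (`∃w A)  = cong `∃w (substPW-cong (liftW-cong e) A)

  substPT-fuse : ∀ {m m' m'' k} (σ : Fin m' → Term m'') (τ : Fin m → Term m') (A : Prop m k) →
    substPT σ (substPT τ A) ≡ substPT (substT σ ∘ τ) A
  substPT-fuse σ τ (atom p ts) = cong (atom p) (substTs-fuse σ τ ts)
  substPT-fuse σ τ (A ⊗ B)  = cong₂ _⊗_ (substPT-fuse σ τ A) (substPT-fuse σ τ B)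
  substPT-fuse σ τ `𝟏       = refl
  substPT-fuse σ τ (A ⊸ B)  = cong₂ _⊸_ (substPT-fuse σ τ A) (substPT-fuse σ τ B)
  substPT-fuse σ τ (A & B)  = cong₂ _&_ (substPT-fuse σ τ A) (substPT-fuse σ τ B)
  substPT-fuse σ τ `⊤       = refl
  substPT-fuse σ τ (A ⊕ B)  = cong₂ _⊕_ (substPT-fuse σ τ A) (substPT-fuse σ τ B)
  substPT-fuse σ τ `𝟎       = refl
  substPT-fuse σ τ (`! A)   = cong `! (substPT-fuse σ τ A)
  substPT-fuse σ τ (`∀t A)  =
    cong `∀t (trans (substPT-fuse (liftT σ) (liftT τ) A) (substPT-cong (liftT-fuse σ τ) A))
  substPT-fuse σ τ (`∃t A)  =
    cong `∃t (trans (substPT-fuse (liftT σ) (liftT τ) A) (substPT-cong (liftT-fuse σ τ) A))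
  substPT-fuse σ τ (A at u) = cong (_at u) (substPT-fuse σ τ A)
  substPT-fuse σ τ (`↓ A)   = cong `↓ (substPT-fuse σ τ A)
  substPT-fuse σ τ (`∀w A)  = cong `∀w (substPT-fuse σ τ A)
  substPT-fuse σ τ (`∃w A)  = cong `∃w (substPT-fuse σ τ A)

  substPW-fuse : ∀ {m k k' k''} (σ : Fin k' → World k'') (τ : Fin k → World k') (A : Prop m k) →
    substPW σ (substPW τ A) ≡ substPW (substW σ ∘ τ) A
  substPW-fuse σ τ (atom p ts) = refl
  substPW-fuse σ τ (A ⊗ B)  = cong₂ _⊗_ (substPW-fuse σ τ A) (substPW-fuse σ τ B)
  substPW-fuse σ τ `𝟏       = refl
  substPW-fuse σ τ (A ⊸ B)  = cong₂ _⊸_ (substPW-fuse σ τ A) (substPW-fuse σ τ B)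
  substPW-fuse σ τ (A & B)  = cong₂ _&_ (substPW-fuse σ τ A) (substPW-fuse σ τ B)
  substPW-fuse σ τ `⊤       = refl
  substPW-fuse σ τ (A ⊕ B)  = cong₂ _⊕_ (substPW-fuse σ τ A) (substPW-fuse σ τ B)
  substPW-fuse σ τ `𝟎       = refl
  substPW-fuse σ τ (`! A)   = cong `! (substPW-fuse σ τ A)
  substPW-fuse σ τ (`∀t A)  = cong `∀t (substPW-fuse σ τ A)
  substPW-fuse σ τ (`∃t A)  = cong `∃t (substPW-fuse σ τ A)
  substPW-fuse σ τ (A at u) = cong₂ _at_ (substPW-fuse σ τ A) (substW-fuse σ τ u)
  substPW-fuse σ τ (`↓ A)   =
    cong `↓ (trans (substPW-fuse (liftW σ) (liftW τ) A) (substPW-cong (liftW-fuse σ τ) A))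
  substPW-fuse σ τ (`∀w A)  =
    cong `∀w (trans (substPW-fuse (liftW σ) (liftW τ) A) (substPW-cong (liftW-fuse σ τ) A))
  substPW-fuse σ τ (`∃w A)  =
    cong `∃w (trans (substPW-fuse (liftW σ) (liftW τ) A) (substPW-cong (liftW-fuse σ τ) A))

  substPT-id : ∀ {m k} (A : Prop m k) → substPT var A ≡ A
  substPT-id (atom p ts) = cong (atom p) (substTs-id ts)
  substPT-id (A ⊗ B)  = cong₂ _⊗_ (substPT-id A) (substPT-id B)
  substPT-id `𝟏       = refl
  substPT-id (A ⊸ B)  = cong₂ _⊸_ (substPT-id A) (substPT-id B)
  substPT-id (A & B)  = cong₂ _&_ (substPT-id A) (substPT-id B)
  substPT-id `⊤       = refl
  substPT-id (A ⊕ B)  = cong₂ _⊕_ (substPT-id A) (substPT-id B)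
  substPT-id `𝟎       = refl
  substPT-id (`! A)   = cong `! (substPT-id A)
  substPT-id (`∀t A)  = cong `∀t (trans (substPT-cong liftT-id A) (substPT-id A))
  substPT-id (`∃t A)  = cong `∃t (trans (substPT-cong liftT-id A) (substPT-id A))
  substPT-id (A at u) = cong (_at u) (substPT-id A)
  substPT-id (`↓ A)   = cong `↓ (substPT-id A)
  substPT-id (`∀w A)  = cong `∀w (substPT-id A)
  substPT-id (`∃w A)  = cong `∃w (substPT-id A)

  substPW-id : ∀ {m k} (A : Prop m k) → substPW wvar A ≡ A
  substPW-id (atom p ts) = refl
  substPW-id (A ⊗ B)  = cong₂ _⊗_ (substPW-id A) (substPW-id B)
  substPW-id `𝟏       = refl
  substPW-id (A ⊸ B)  = cong₂ _⊸_ (substPW-id A) (substPW-id B)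
  substPW-id (A & B)  = cong₂ _&_ (substPW-id A) (substPW-id B)
  substPW-id `⊤       = refl
  substPW-id (A ⊕ B)  = cong₂ _⊕_ (substPW-id A) (substPW-id B)
  substPW-id `𝟎       = refl
  substPW-id (`! A)   = cong `! (substPW-id A)
  substPW-id (`∀t A)  = cong `∀t (substPW-id A)
  substPW-id (`∃t A)  = cong `∃t (substPW-id A)
  substPW-id (A at u) = cong₂ _at_ (substPW-id A) (substW-id u)
  substPW-id (`↓ A)   = cong `↓ (trans (substPW-cong liftW-id A) (substPW-id A))
  substPW-id (`∀w A)  = cong `∀w (trans (substPW-cong liftW-id A) (substPW-id A))
  substPW-id (`∃w A)  = cong `∃w (trans (substPW-cong liftW-id A) (substPW-id A))

  -- Term and world substitutions act on disjoint kinds of variables.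
  substPT-substPW-comm : ∀ {m m' k k'} (σ : Fin m → Term m') (ρ : Fin k → World k') (A : Prop m k) →
    substPT σ (substPW ρ A) ≡ substPW ρ (substPT σ A)
  substPT-substPW-comm σ ρ (atom p ts) = refl
  substPT-substPW-comm σ ρ (A ⊗ B)  = cong₂ _⊗_ (substPT-substPW-comm σ ρ A) (substPT-substPW-comm σ ρ B)
  substPT-substPW-comm σ ρ `𝟏       = refl
  substPT-substPW-comm σ ρ (A ⊸ B)  = cong₂ _⊸_ (substPT-substPW-comm σ ρ A) (substPT-substPW-comm σ ρ B)
  substPT-substPW-comm σ ρ (A & B)  = cong₂ _&_ (substPT-substPW-comm σ ρ A) (substPT-substPW-comm σ ρ B)
  substPT-substPW-comm σ ρ `⊤       = refl
  substPT-substPW-comm σ ρ (A ⊕ B)  = cong₂ _⊕_ (substPT-substPW-comm σ ρ A) (substPT-substPW-comm σ ρ B)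
  substPT-substPW-comm σ ρ `𝟎       = refl
  substPT-substPW-comm σ ρ (`! A)   = cong `! (substPT-substPW-comm σ ρ A)
  substPT-substPW-comm σ ρ (`∀t A)  = cong `∀t (substPT-substPW-comm (liftT σ) ρ A)
  substPT-substPW-comm σ ρ (`∃t A)  = cong `∃t (substPT-substPW-comm (liftT σ) ρ A)
  substPT-substPW-comm σ ρ (A at u) = cong (_at _) (substPT-substPW-comm σ ρ A)
  substPT-substPW-comm σ ρ (`↓ A)   = cong `↓ (substPT-substPW-comm σ (liftW ρ) A)
  substPT-substPW-comm σ ρ (`∀w A)  = cong `∀w (substPT-substPW-comm σ (liftW ρ) A)
  substPT-substPW-comm σ ρ (`∃w A)  = cong `∃w (substPT-substPW-comm σ (liftW ρ) A)

  substW-square : ∀ {k₁ k₂ k₃ k₄} (σ : Fin k₂ → World k₄) (τ : Fin k₁ → World k₂)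
    (σ' : Fin k₃ → World k₄) (τ' : Fin k₁ → World k₃) →
    substW σ ∘ τ ≗ substW σ' ∘ τ' → (w : World k₁) → substW σ (substW τ w) ≡ substW σ' (substW τ' w)
  substW-square σ τ σ' τ' e w =
    trans (substW-fuse σ τ w) (trans (substW-cong e w) (sym (substW-fuse σ' τ' w)))

  substPT-square : ∀ {m₁ m₂ m₃ m₄ k} (σ : Fin m₂ → Term m₄) (τ : Fin m₁ → Term m₂)
    (σ' : Fin m₃ → Term m₄) (τ' : Fin m₁ → Term m₃) →
    substT σ ∘ τ ≗ substT σ' ∘ τ' → (A : Prop m₁ k) → substPT σ (substPT τ A) ≡ substPT σ' (substPT τ' A)
  substPT-square σ τ σ' τ' e A =
    trans (substPT-fuse σ τ A) (trans (substPT-cong e A) (sym (substPT-fuse σ' τ' A)))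

  substPW-square : ∀ {m k₁ k₂ k₃ k₄} (σ : Fin k₂ → World k₄) (τ : Fin k₁ → World k₂)
    (σ' : Fin k₃ → World k₄) (τ' : Fin k₁ → World k₃) →
    substW σ ∘ τ ≗ substW σ' ∘ τ' → (A : Prop m k₁) → substPW σ (substPW τ A) ≡ substPW σ' (substPW τ' A)
  substPW-square σ τ σ' τ' e A =
    trans (substPW-fuse σ τ A) (trans (substPW-cong e A) (sym (substPW-fuse σ' τ' A)))

  wkT : ∀ {m} → Fin m → Term (suc m)
  wkT j = var (suc j)

  wkW : ∀ {k} → Fin k → World (suc k)
  wkW j = wvar (suc j)

  substT-wk-inst : ∀ {m} (s : Term m) (t : Term m) → substT (sub1T s) (substT wkT t) ≡ t
  substT-wk-inst s t = trans (substT-fuse (sub1T s) wkT t) (substT-id t)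

  substW-wk-inst : ∀ {k} (v w : World k) → substW (sub1W v) (↑W w) ≡ w
  substW-wk-inst v w = trans (substW-fuse (sub1W v) wkW w) (substW-id w)

  substPT-wk-inst : ∀ {m k} (t : Term m) (A : Prop m k) → substPT (sub1T t) (substPT wkT A) ≡ A
  substPT-wk-inst t A = trans (substPT-fuse (sub1T t) wkT A) (substPT-id A)

  substPW-wk-inst : ∀ {m k} (v : World k) (A : Prop m k) → substPW (sub1W v) (substPW wkW A) ≡ A
  substPW-wk-inst v A = trans (substPW-fuse (sub1W v) wkW A) (substPW-id A)

  instT-fresh : ∀ {m k} (A : Prop (suc m) k) → A ≡ [ var zero /x] (substPT (liftT wkT) A)
  instT-fresh A = sym (begin
    [ var zero /x] (substPT (liftT wkT) A)            ≡⟨ substPT-fuse _ _ A ⟩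
    substPT (substT (sub1T (var zero)) ∘ liftT wkT) A ≡⟨ substPT-cong fresh A ⟩
    substPT var A                                     ≡⟨ substPT-id A ⟩
    A                                                 ∎)
    where
    open ≡-Reasoning
    fresh : substT (sub1T (var zero)) ∘ liftT wkT ≗ var
    fresh zero    = refl
    fresh (suc i) = refl

  instW-fresh : ∀ {m k} (A : Prop m (suc k)) → A ≡ [ wvar zero /u] (substPW (liftW wkW) A)
  instW-fresh A = sym (begin
    [ wvar zero /u] (substPW (liftW wkW) A)             ≡⟨ substPW-fuse _ _ A ⟩
    substPW (substW (sub1W (wvar zero)) ∘ liftW wkW) A ≡⟨ substPW-cong fresh A ⟩
    substPW wvar A                                     ≡⟨ substPW-id A ⟩
    A                                                  ∎)
    where
    open ≡-Reasoning
    fresh : substW (sub1W (wvar zero)) ∘ liftW wkW ≗ wvar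
    fresh zero    = refl
    fresh (suc i) = refl

  substPT-instT : ∀ {m m' k} (σ : Fin m → Term m') (t : Term m) (A : Prop (suc m) k) →
    substPT σ ([ t /x] A) ≡ [ substT σ t /x] (substPT (liftT σ) A)
  substPT-instT σ t A = substPT-square σ (sub1T t) (sub1T (substT σ t)) (liftT σ) agree A
    where
    agree : substT σ ∘ sub1T t ≗ substT (sub1T (substT σ t)) ∘ liftT σ
    agree zero    = refl
    agree (suc i) = sym (substT-wk-inst (substT σ t) (σ i))

  substPW-instW : ∀ {m k k'} (ρ : Fin k → World k') (v : World k) (A : Prop m (suc k)) →
    substPW ρ ([ v /u] A) ≡ [ substW ρ v /u] (substPW (liftW ρ) A)
  substPW-instW ρ v A = substPW-square ρ (sub1W v) (sub1W (substW ρ v)) (liftW ρ) agree A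
    where
    agree : substW ρ ∘ sub1W v ≗ substW (sub1W (substW ρ v)) ∘ liftW ρ
    agree zero    = refl
    agree (suc i) = sym (substW-wk-inst (substW ρ v) (ρ i))

  substPT-instW : ∀ {m m' k} (σ : Fin m → Term m') (v : World k) (A : Prop m (suc k)) →
    substPT σ ([ v /u] A) ≡ [ v /u] (substPT σ A)
  substPT-instW σ v A = substPT-substPW-comm σ (sub1W v) A

  substPW-instT : ∀ {m k k'} (ρ : Fin k → World k') (t : Term m) (A : Prop (suc m) k) →
    substPW ρ ([ t /x] A) ≡ [ t /x] (substPW ρ A)
  substPW-instT ρ t A = sym (substPT-substPW-comm (sub1T t) ρ A)

  substJT : ∀ {m m' k} → (Fin m → Term m') → Jdg m k → Jdg m' k
  substJT σ (A ＠ w) = substPT σ A ＠ w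

  substJW : ∀ {m k k'} → (Fin k → World k') → Jdg m k → Jdg m k'
  substJW ρ (A ＠ w) = substPW ρ A ＠ substW ρ w

  substJT-wk : ∀ {m k} (J : Jdg m k) → substJT wkT J ≡ ↑tJ J
  substJT-wk (A ＠ w) = refl

  substJW-wk : ∀ {m k} (J : Jdg m k) → substJW wkW J ≡ ↑wJ J
  substJW-wk (A ＠ w) = refl

  substW-lift-↑W : ∀ {k k'} (ρ : Fin k → World k') (w : World k) →
    substW (liftW ρ) (↑W w) ≡ ↑W (substW ρ w)
  substW-lift-↑W ρ w = substW-square (liftW ρ) wkW wkW ρ (λ i → refl) w

  substJT-lift-↑t : ∀ {m m' k} (σ : Fin m → Term m') (J : Jdg m k) →
    substJT (liftT σ) (↑tJ J) ≡ ↑tJ (substJT σ J)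
  substJT-lift-↑t σ (A ＠ w) = cong (_＠ w) (substPT-square (liftT σ) wkT wkT σ (λ i → refl) A)

  substJW-lift-↑w : ∀ {m k k'} (ρ : Fin k → World k') (J : Jdg m k) →
    substJW (liftW ρ) (↑wJ J) ≡ ↑wJ (substJW ρ J)
  substJW-lift-↑w ρ (A ＠ w) =
    cong₂ _＠_ (substPW-square (liftW ρ) wkW wkW ρ (λ i → refl) A) (substW-lift-↑W ρ w)

  substJT-↑w : ∀ {m m' k} (σ : Fin m → Term m') (J : Jdg m k) → substJT σ (↑wJ J) ≡ ↑wJ (substJT σ J)
  substJT-↑w σ (A ＠ w) = cong (_＠ ↑W w) (substPT-substPW-comm σ wkW A)

  substJW-↑t : ∀ {m k k'} (ρ : Fin k → World k') (J : Jdg m k) → substJW ρ (↑tJ J) ≡ ↑tJ (substJW ρ J)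
  substJW-↑t ρ (A ＠ w) = cong (_＠ substW ρ w) (sym (substPT-substPW-comm wkT ρ A))

  substJT-wk-inst : ∀ {m k} (t : Term m) (J : Jdg m k) → substJT (sub1T t) (↑tJ J) ≡ J
  substJT-wk-inst t (A ＠ w) = cong (_＠ w) (substPT-wk-inst t A)

  substJW-wk-inst : ∀ {m k} (v : World k) (J : Jdg m k) → substJW (sub1W v) (↑wJ J) ≡ J
  substJW-wk-inst v (A ＠ w) = cong₂ _＠_ (substPW-wk-inst v A) (substW-wk-inst v w)

  substJT-wk* : ∀ {m k} (Γ : List (Jdg m k)) → map (substJT wkT) Γ ≡ ↑t* Γ
  substJT-wk* = map-cong substJT-wk

  substJW-wk* : ∀ {m k} (Γ : List (Jdg m k)) → map (substJW wkW) Γ ≡ ↑w* Γ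
  substJW-wk* = map-cong substJW-wk

  substJT-lift-↑t* : ∀ {m m' k} (σ : Fin m → Term m') (Γ : List (Jdg m k)) →
    map (substJT (liftT σ)) (↑t* Γ) ≡ ↑t* (map (substJT σ) Γ)
  substJT-lift-↑t* σ = map-square (substJT-lift-↑t σ)

  substJW-lift-↑w* : ∀ {m k k'} (ρ : Fin k → World k') (Γ : List (Jdg m k)) →
    map (substJW (liftW ρ)) (↑w* Γ) ≡ ↑w* (map (substJW ρ) Γ)
  substJW-lift-↑w* ρ = map-square (substJW-lift-↑w ρ)

  substJT-↑w* : ∀ {m m' k} (σ : Fin m → Term m') (Γ : List (Jdg m k)) →
    map (substJT σ) (↑w* Γ) ≡ ↑w* (map (substJT σ) Γ)
  substJT-↑w* σ = map-square (substJT-↑w σ)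

  substJW-↑t* : ∀ {m k k'} (ρ : Fin k → World k') (Γ : List (Jdg m k)) →
    map (substJW ρ) (↑t* Γ) ≡ ↑t* (map (substJW ρ) Γ)
  substJW-↑t* ρ = map-square (substJW-↑t ρ)

  substJT-wk-inst* : ∀ {m k} (t : Term m) (Γ : List (Jdg m k)) → map (substJT (sub1T t)) (↑t* Γ) ≡ Γ
  substJT-wk-inst* t = map-cancel (substJT-wk-inst t)

  substJW-wk-inst* : ∀ {m k} (v : World k) (Γ : List (Jdg m k)) → map (substJW (sub1W v)) (↑w* Γ) ≡ Γ
  substJW-wk-inst* v = map-cancel (substJW-wk-inst v)

module Structural {c ℓ : Level} (𝒲 : Monoid c ℓ) (Sig : Signature) where
  open HyLL 𝒲 Sig
  open Substitution 𝒲 Sig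

  cast : ∀ {m k} {Γ Γ' Δ Δ' : List (Jdg m k)} {J J'} →
    Γ ≡ Γ' → Δ ≡ Δ' → J ≡ J' → Γ ⨾ Δ ⟹ J → Γ' ⨾ Δ' ⟹ J'
  cast refl refl refl d = d

  exchange : ∀ {m k} {Γ Δ Δ' : List (Jdg m k)} {J} → Δ ↭ Δ' → Γ ⨾ Δ ⟹ J → Γ ⨾ Δ' ⟹ J
  exchange p init with ↭-singleton-inv (↭-sym p)
  ... | refl = init
  exchange p (copy x d)   = copy x (exchange (prep _ p) d)
  exchange p (⊗R q d e)   = ⊗R (↭-trans (↭-sym p) q) d e
  exchange p (⊗L q d)     = ⊗L (↭-trans (↭-sym p) q) d
  exchange p 𝟏R with ↭-empty-inv (↭-sym p)
  ... | refl = 𝟏R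
  exchange p (𝟏L q d)     = 𝟏L (↭-trans (↭-sym p) q) d
  exchange p (⊸R d)       = ⊸R (exchange (prep _ p) d)
  exchange p (⊸L q d e)   = ⊸L (↭-trans (↭-sym p) q) d e
  exchange p ⊤R           = ⊤R
  exchange p (&R d e)     = &R (exchange p d) (exchange p e)
  exchange p (&L₁ q d)    = &L₁ (↭-trans (↭-sym p) q) d
  exchange p (&L₂ q d)    = &L₂ (↭-trans (↭-sym p) q) d
  exchange p (⊕R₁ d)      = ⊕R₁ (exchange p d)
  exchange p (⊕R₂ d)      = ⊕R₂ (exchange p d)
  exchange p (⊕L q d e)   = ⊕L (↭-trans (↭-sym p) q) d e
  exchange p (𝟎L q)       = 𝟎L (↭-trans (↭-sym p) q)
  exchange p (∀tR d)      = ∀tR (exchange (map⁺ ↑tJ p) d)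
  exchange p (∀wR d)      = ∀wR (exchange (map⁺ ↑wJ p) d)
  exchange p (∀tL t q d)  = ∀tL t (↭-trans (↭-sym p) q) d
  exchange p (∀wL v q d)  = ∀wL v (↭-trans (↭-sym p) q) d
  exchange p (∃tR t d)    = ∃tR t (exchange p d)
  exchange p (∃wR v d)    = ∃wR v (exchange p d)
  exchange p (∃tL q d)    = ∃tL (↭-trans (↭-sym p) q) d
  exchange p (∃wL q d)    = ∃wL (↭-trans (↭-sym p) q) d
  exchange p (!R d) with ↭-empty-inv (↭-sym p)
  ... | refl = !R d
  exchange p (!L q d)     = !L (↭-trans (↭-sym p) q) d
  exchange p (atR d)      = atR (exchange p d)
  exchange p (atL q d)    = atL (↭-trans (↭-sym p) q) d
  exchange p (↓R d)       = ↓R (exchange p d)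
  exchange p (↓L q d)     = ↓L (↭-trans (↭-sym p) q) d

  _⊆_ : ∀ {m k} → List (Jdg m k) → List (Jdg m k) → Set c
  Γ ⊆ Γ' = ∀ {x} → x ∈ Γ → x ∈ Γ'

  map-⊆ : ∀ {m k m' k'} (f : Jdg m k → Jdg m' k') {Γ Γ'} → Γ ⊆ Γ' → map f Γ ⊆ map f Γ'
  map-⊆ f Γ⊆Γ' x∈ with ∈-map⁻ f x∈
  ... | y , y∈ , refl = ∈-map⁺ f (Γ⊆Γ' y∈)

  ∷-⊆ : ∀ {m k} {x : Jdg m k} {Γ Γ'} → Γ ⊆ Γ' → (x ∷ Γ) ⊆ (x ∷ Γ')
  ∷-⊆ Γ⊆Γ' (here e)  = here e
  ∷-⊆ Γ⊆Γ' (there y) = there (Γ⊆Γ' y)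

  weakenΓ : ∀ {m k} {Γ Γ' Δ : List (Jdg m k)} {J} → Γ ⊆ Γ' → Γ ⨾ Δ ⟹ J → Γ' ⨾ Δ ⟹ J
  weakenΓ s init         = init
  weakenΓ s (copy x d)   = copy (s x) (weakenΓ s d)
  weakenΓ s (⊗R q d e)   = ⊗R q (weakenΓ s d) (weakenΓ s e)
  weakenΓ s (⊗L q d)     = ⊗L q (weakenΓ s d)
  weakenΓ s 𝟏R           = 𝟏R
  weakenΓ s (𝟏L q d)     = 𝟏L q (weakenΓ s d)
  weakenΓ s (⊸R d)       = ⊸R (weakenΓ s d)
  weakenΓ s (⊸L q d e)   = ⊸L q (weakenΓ s d) (weakenΓ s e)
  weakenΓ s ⊤R           = ⊤R
  weakenΓ s (&R d e)     = &R (weakenΓ s d) (weakenΓ s e)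
  weakenΓ s (&L₁ q d)    = &L₁ q (weakenΓ s d)
  weakenΓ s (&L₂ q d)    = &L₂ q (weakenΓ s d)
  weakenΓ s (⊕R₁ d)      = ⊕R₁ (weakenΓ s d)
  weakenΓ s (⊕R₂ d)      = ⊕R₂ (weakenΓ s d)
  weakenΓ s (⊕L q d e)   = ⊕L q (weakenΓ s d) (weakenΓ s e)
  weakenΓ s (𝟎L q)       = 𝟎L q
  weakenΓ s (∀tR d)      = ∀tR (weakenΓ (map-⊆ ↑tJ s) d)
  weakenΓ s (∀wR d)      = ∀wR (weakenΓ (map-⊆ ↑wJ s) d)
  weakenΓ s (∀tL t q d)  = ∀tL t q (weakenΓ s d)
  weakenΓ s (∀wL v q d)  = ∀wL v q (weakenΓ s d)
  weakenΓ s (∃tR t d)    = ∃tR t (weakenΓ s d)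
  weakenΓ s (∃wR v d)    = ∃wR v (weakenΓ s d)
  weakenΓ s (∃tL q d)    = ∃tL q (weakenΓ (map-⊆ ↑tJ s) d)
  weakenΓ s (∃wL q d)    = ∃wL q (weakenΓ (map-⊆ ↑wJ s) d)
  weakenΓ s (!R d)       = !R (weakenΓ s d)
  weakenΓ s (!L q d)     = !L q (weakenΓ (∷-⊆ s) d)
  weakenΓ s (atR d)      = atR (weakenΓ s d)
  weakenΓ s (atL q d)    = atL q (weakenΓ s d)
  weakenΓ s (↓R d)       = ↓R (weakenΓ s d)
  weakenΓ s (↓L q d)     = ↓L q (weakenΓ s d)

  weaken-prefix : ∀ {m k} G {Γ Δ : List (Jdg m k)} {J} → Γ ⨾ Δ ⟹ J → G ++ Γ ⨾ Δ ⟹ J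
  weaken-prefix G = weakenΓ (∈-++⁺ʳ G)

  substDerivT : ∀ {m m' k} (σ : Fin m → Term m') {Γ Δ : List (Jdg m k)} {J} → Γ ⨾ Δ ⟹ J →
    map (substJT σ) Γ ⨾ map (substJT σ) Δ ⟹ substJT σ J
  substDerivT σ init = init
  substDerivT σ (copy x d) = copy (∈-map⁺ (substJT σ) x) (substDerivT σ d)
  substDerivT σ (⊗R {Δ₁ = Δ₁} {Δ₂} p d e) =
    ⊗R (map⁺-++ (substJT σ) Δ₁ Δ₂ p) (substDerivT σ d) (substDerivT σ e)
  substDerivT σ (⊗L p d) = ⊗L (map⁺ (substJT σ) p) (substDerivT σ d)
  substDerivT σ 𝟏R = 𝟏R
  substDerivT σ (𝟏L p d) = 𝟏L (map⁺ (substJT σ) p) (substDerivT σ d)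
  substDerivT σ (⊸R d) = ⊸R (substDerivT σ d)
  substDerivT σ (⊸L {Δ₁ = Δ₁} {Δ₂} p d e) =
    ⊸L (map⁺-∷++ (substJT σ) _ Δ₁ Δ₂ p) (substDerivT σ d) (substDerivT σ e)
  substDerivT σ ⊤R = ⊤R
  substDerivT σ (&R d e) = &R (substDerivT σ d) (substDerivT σ e)
  substDerivT σ (&L₁ p d) = &L₁ (map⁺ (substJT σ) p) (substDerivT σ d)
  substDerivT σ (&L₂ p d) = &L₂ (map⁺ (substJT σ) p) (substDerivT σ d)
  substDerivT σ (⊕R₁ d) = ⊕R₁ (substDerivT σ d)
  substDerivT σ (⊕R₂ d) = ⊕R₂ (substDerivT σ d)
  substDerivT σ (⊕L p d e) = ⊕L (map⁺ (substJT σ) p) (substDerivT σ d) (substDerivT σ e)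
  substDerivT σ (𝟎L p) = 𝟎L (map⁺ (substJT σ) p)
  substDerivT σ {Γ} {Δ} (∀tR d) =
    ∀tR (cast (substJT-lift-↑t* σ Γ) (substJT-lift-↑t* σ Δ) refl (substDerivT (liftT σ) d))
  substDerivT σ {Γ} {Δ} (∀wR d) =
    ∀wR (cast (substJT-↑w* σ Γ) (substJT-↑w* σ Δ) refl (substDerivT σ d))
  substDerivT σ (∀tL {A = A} t p d) = ∀tL (substT σ t) (map⁺ (substJT σ) p)
    (cast refl (cong (λ X → (X ＠ _) ∷ _) (substPT-instT σ t A)) refl (substDerivT σ d))
  substDerivT σ (∀wL {A = A} v p d) = ∀wL v (map⁺ (substJT σ) p)
    (cast refl (cong (λ X → (X ＠ _) ∷ _) (substPT-instW σ v A)) refl (substDerivT σ d))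
  substDerivT σ (∃tR {A = A} t d) =
    ∃tR (substT σ t) (cast refl refl (cong (_＠ _) (substPT-instT σ t A)) (substDerivT σ d))
  substDerivT σ (∃wR {A = A} v d) =
    ∃wR v (cast refl refl (cong (_＠ _) (substPT-instW σ v A)) (substDerivT σ d))
  substDerivT σ {Γ} {J = J} (∃tL {Δ₀ = Δ₀} p d) = ∃tL (map⁺ (substJT σ) p)
    (cast (substJT-lift-↑t* σ Γ) (cong (_ ∷_) (substJT-lift-↑t* σ Δ₀)) (substJT-lift-↑t σ J)
      (substDerivT (liftT σ) d))
  substDerivT σ {Γ} {J = J} (∃wL {Δ₀ = Δ₀} p d) = ∃wL (map⁺ (substJT σ) p)
    (cast (substJT-↑w* σ Γ) (cong (_ ∷_) (substJT-↑w* σ Δ₀)) (substJT-↑w σ J) (substDerivT σ d))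
  substDerivT σ (!R d) = !R (substDerivT σ d)
  substDerivT σ (!L p d) = !L (map⁺ (substJT σ) p) (substDerivT σ d)
  substDerivT σ (atR d) = atR (substDerivT σ d)
  substDerivT σ (atL p d) = atL (map⁺ (substJT σ) p) (substDerivT σ d)
  substDerivT σ (↓R {A = A} {w} d) =
    ↓R (cast refl refl (cong (_＠ _) (substPT-instW σ w A)) (substDerivT σ d))
  substDerivT σ (↓L {A = A} {v} p d) = ↓L (map⁺ (substJT σ) p)
    (cast refl (cong (λ X → (X ＠ _) ∷ _) (substPT-instW σ v A)) refl (substDerivT σ d))

  substDerivW : ∀ {m k k'} (ρ : Fin k → World k') {Γ Δ : List (Jdg m k)} {J} → Γ ⨾ Δ ⟹ J →
    map (substJW ρ) Γ ⨾ map (substJW ρ) Δ ⟹ substJW ρ J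
  substDerivW ρ init = init
  substDerivW ρ (copy x d) = copy (∈-map⁺ (substJW ρ) x) (substDerivW ρ d)
  substDerivW ρ (⊗R {Δ₁ = Δ₁} {Δ₂} p d e) =
    ⊗R (map⁺-++ (substJW ρ) Δ₁ Δ₂ p) (substDerivW ρ d) (substDerivW ρ e)
  substDerivW ρ (⊗L p d) = ⊗L (map⁺ (substJW ρ) p) (substDerivW ρ d)
  substDerivW ρ 𝟏R = 𝟏R
  substDerivW ρ (𝟏L p d) = 𝟏L (map⁺ (substJW ρ) p) (substDerivW ρ d)
  substDerivW ρ (⊸R d) = ⊸R (substDerivW ρ d)
  substDerivW ρ (⊸L {Δ₁ = Δ₁} {Δ₂} p d e) =
    ⊸L (map⁺-∷++ (substJW ρ) _ Δ₁ Δ₂ p) (substDerivW ρ d) (substDerivW ρ e)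
  substDerivW ρ ⊤R = ⊤R
  substDerivW ρ (&R d e) = &R (substDerivW ρ d) (substDerivW ρ e)
  substDerivW ρ (&L₁ p d) = &L₁ (map⁺ (substJW ρ) p) (substDerivW ρ d)
  substDerivW ρ (&L₂ p d) = &L₂ (map⁺ (substJW ρ) p) (substDerivW ρ d)
  substDerivW ρ (⊕R₁ d) = ⊕R₁ (substDerivW ρ d)
  substDerivW ρ (⊕R₂ d) = ⊕R₂ (substDerivW ρ d)
  substDerivW ρ (⊕L p d e) = ⊕L (map⁺ (substJW ρ) p) (substDerivW ρ d) (substDerivW ρ e)
  substDerivW ρ (𝟎L p) = 𝟎L (map⁺ (substJW ρ) p)
  substDerivW ρ {Γ} {Δ} (∀tR d) =
    ∀tR (cast (substJW-↑t* ρ Γ) (substJW-↑t* ρ Δ) refl (substDerivW ρ d))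
  substDerivW ρ {Γ} {Δ} (∀wR {w = w} d) =
    ∀wR (cast (substJW-lift-↑w* ρ Γ) (substJW-lift-↑w* ρ Δ) (cong (_ ＠_) (substW-lift-↑W ρ w))
      (substDerivW (liftW ρ) d))
  substDerivW ρ (∀tL {A = A} t p d) = ∀tL t (map⁺ (substJW ρ) p)
    (cast refl (cong (λ X → (X ＠ _) ∷ _) (substPW-instT ρ t A)) refl (substDerivW ρ d))
  substDerivW ρ (∀wL {A = A} v p d) = ∀wL (substW ρ v) (map⁺ (substJW ρ) p)
    (cast refl (cong (λ X → (X ＠ _) ∷ _) (substPW-instW ρ v A)) refl (substDerivW ρ d))
  substDerivW ρ (∃tR {A = A} t d) =
    ∃tR t (cast refl refl (cong (_＠ _) (substPW-instT ρ t A)) (substDerivW ρ d))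
  substDerivW ρ (∃wR {A = A} v d) =
    ∃wR (substW ρ v) (cast refl refl (cong (_＠ _) (substPW-instW ρ v A)) (substDerivW ρ d))
  substDerivW ρ {Γ} {J = J} (∃tL {Δ₀ = Δ₀} p d) = ∃tL (map⁺ (substJW ρ) p)
    (cast (substJW-↑t* ρ Γ) (cong (_ ∷_) (substJW-↑t* ρ Δ₀)) (substJW-↑t ρ J) (substDerivW ρ d))
  substDerivW ρ {Γ} {J = J} (∃wL {Δ₀ = Δ₀} {u = u} p d) = ∃wL (map⁺ (substJW ρ) p)
    (cast (substJW-lift-↑w* ρ Γ)
          (cong₂ _∷_ (cong (_ ＠_) (substW-lift-↑W ρ u)) (substJW-lift-↑w* ρ Δ₀))
          (substJW-lift-↑w ρ J)
      (substDerivW (liftW ρ) d))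
  substDerivW ρ (!R d) = !R (substDerivW ρ d)
  substDerivW ρ (!L p d) = !L (map⁺ (substJW ρ) p) (substDerivW ρ d)
  substDerivW ρ (atR d) = atR (substDerivW ρ d)
  substDerivW ρ (atL p d) = atL (map⁺ (substJW ρ) p) (substDerivW ρ d)
  substDerivW ρ (↓R {A = A} {w} d) =
    ↓R (cast refl refl (cong (_＠ _) (substPW-instW ρ w A)) (substDerivW ρ d))
  substDerivW ρ (↓L {A = A} {v} p d) = ↓L (map⁺ (substJW ρ) p)
    (cast refl (cong (λ X → (X ＠ _) ∷ _) (substPW-instW ρ v A)) refl (substDerivW ρ d))

  weakenT : ∀ {m k} {Γ Δ : List (Jdg m k)} {J} → Γ ⨾ Δ ⟹ J → ↑t* Γ ⨾ ↑t* Δ ⟹ ↑tJ J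
  weakenT {Γ = Γ} {Δ} {J} d = cast (substJT-wk* Γ) (substJT-wk* Δ) (substJT-wk J) (substDerivT wkT d)

  weakenW : ∀ {m k} {Γ Δ : List (Jdg m k)} {J} → Γ ⨾ Δ ⟹ J → ↑w* Γ ⨾ ↑w* Δ ⟹ ↑wJ J
  weakenW {Γ = Γ} {Δ} {J} d = cast (substJW-wk* Γ) (substJW-wk* Δ) (substJW-wk J) (substDerivW wkW d)

  ∀tR-instance : ∀ {m k} (t : Term m) {Γ Δ : List (Jdg m k)} {A w} →
    ↑t* Γ ⨾ ↑t* Δ ⟹ A ＠ w → Γ ⨾ Δ ⟹ [ t /x] A ＠ w
  ∀tR-instance t {Γ} {Δ} d =
    cast (substJT-wk-inst* t Γ) (substJT-wk-inst* t Δ) refl (substDerivT (sub1T t) d)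

  ∀wR-instance : ∀ {m k} (v : World k) {Γ Δ : List (Jdg m k)} {A w} →
    ↑w* Γ ⨾ ↑w* Δ ⟹ A ＠ ↑W w → Γ ⨾ Δ ⟹ [ v /u] A ＠ w
  ∀wR-instance v {Γ} {Δ} {w = w} d =
    cast (substJW-wk-inst* v Γ) (substJW-wk-inst* v Δ) (cong (_ ＠_) (substW-wk-inst v w))
      (substDerivW (sub1W v) d)

  ∃tL-instance : ∀ {m k} (t : Term m) {Γ Δ : List (Jdg m k)} {A u J} →
    ↑t* Γ ⨾ (A ＠ u) ∷ ↑t* Δ ⟹ ↑tJ J → Γ ⨾ ([ t /x] A ＠ u) ∷ Δ ⟹ J
  ∃tL-instance t {Γ} {Δ} {J = J} d =
    cast (substJT-wk-inst* t Γ) (cong (_ ∷_) (substJT-wk-inst* t Δ)) (substJT-wk-inst t J)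
      (substDerivT (sub1T t) d)

  ∃wL-instance : ∀ {m k} (v : World k) {Γ Δ : List (Jdg m k)} {A u J} →
    ↑w* Γ ⨾ (A ＠ ↑W u) ∷ ↑w* Δ ⟹ ↑wJ J → Γ ⨾ ([ v /u] A ＠ u) ∷ Δ ⟹ J
  ∃wL-instance v {Γ} {Δ} {u = u} {J} d =
    cast (substJW-wk-inst* v Γ) (cong₂ _∷_ (cong (_ ＠_) (substW-wk-inst v u)) (substJW-wk-inst* v Δ))
      (substJW-wk-inst v J) (substDerivW (sub1W v) d)

  -- A weakened context split into pieces is the weakening of the whole;
  -- needed when an inversion is pushed under ∃L.
  reassemble-↑t : ∀ {m k} {G Γ L Δ : List (Jdg m k)} {E J} →
    ↑t* G ++ ↑t* Γ ⨾ ↑t* L ++ E ∷ ↑t* Δ ⟹ J → ↑t* (G ++ Γ) ⨾ E ∷ ↑t* (L ++ Δ) ⟹ J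
  reassemble-↑t {G = G} {Γ} {L} {Δ} d =
    cast (sym (map-++ ↑tJ G Γ)) (cong (_ ∷_) (sym (map-++ ↑tJ L Δ))) refl (exchange (shift _ (↑t* L) _) d)

  reassemble-↑w : ∀ {m k} {G Γ L Δ : List (Jdg m k)} {E J} →
    ↑w* G ++ ↑w* Γ ⨾ ↑w* L ++ E ∷ ↑w* Δ ⟹ J → ↑w* (G ++ Γ) ⨾ E ∷ ↑w* (L ++ Δ) ⟹ J
  reassemble-↑w {G = G} {Γ} {L} {Δ} d =
    cast (sym (map-++ ↑wJ G Γ)) (cong (_ ∷_) (sym (map-++ ↑wJ L Δ))) refl (exchange (shift _ (↑w* L) _) d)

module RightInversion {c ℓ : Level} (𝒲 : Monoid c ℓ) (Sig : Signature) where
  open HyLL 𝒲 Sig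
  open Substitution 𝒲 Sig
  open Structural 𝒲 Sig

  -- RightStep P L Q: the right rule with conclusion Γ ; Δ ⟹ P has a premise
  -- Γ ; L ++ Δ ⟹ Q.  The quantifier cases allow any instance, and the
  -- instance is given up to equality, so that RightStep is stable under
  -- weakening (see below).
  data RightStep {m k} : Jdg m k → List (Jdg m k) → Jdg m k → Set c where
    &ʳ₁ : ∀ {A B w} → RightStep (A & B ＠ w) [] (A ＠ w)
    &ʳ₂ : ∀ {A B w} → RightStep (A & B ＠ w) [] (B ＠ w)
    ⊸ʳ  : ∀ {A B w} → RightStep (A ⊸ B ＠ w) [ A ＠ w ] (B ＠ w)
    atʳ : ∀ {A u v} → RightStep ((A at u) ＠ v) [] (A ＠ u)
    ↓ʳ  : ∀ {A w X} → X ≡ [ w /u] A → RightStep (`↓ A ＠ w) [] (X ＠ w)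
    ∀tʳ : ∀ {A w X} (t : Term m) → X ≡ [ t /x] A → RightStep (`∀t A ＠ w) [] (X ＠ w)
    ∀wʳ : ∀ {A w X} (v : World k) → X ≡ [ v /u] A → RightStep (`∀w A ＠ w) [] (X ＠ w)

  -- Right steps are stable under weakening by a fresh variable of either
  -- sort; this lets invertR pass under ∃L.
  RightStep-↑t : ∀ {m k} {P : Jdg m k} {L Q} → RightStep P L Q → RightStep (↑tJ P) (↑t* L) (↑tJ Q)
  RightStep-↑t &ʳ₁ = &ʳ₁
  RightStep-↑t &ʳ₂ = &ʳ₂
  RightStep-↑t ⊸ʳ  = ⊸ʳ
  RightStep-↑t atʳ = atʳ
  RightStep-↑t (↓ʳ {A} {w} refl)     = ↓ʳ (substPT-instW wkT w A)
  RightStep-↑t (∀tʳ {A} t refl)      = ∀tʳ (substT wkT t) (substPT-instT wkT t A)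
  RightStep-↑t (∀wʳ {A} v refl)      = ∀wʳ v (substPT-instW wkT v A)

  RightStep-↑w : ∀ {m k} {P : Jdg m k} {L Q} → RightStep P L Q → RightStep (↑wJ P) (↑w* L) (↑wJ Q)
  RightStep-↑w &ʳ₁ = &ʳ₁
  RightStep-↑w &ʳ₂ = &ʳ₂
  RightStep-↑w ⊸ʳ  = ⊸ʳ
  RightStep-↑w atʳ = atʳ
  RightStep-↑w (↓ʳ {A} {w} refl)     = ↓ʳ (substPW-instW wkW w A)
  RightStep-↑w (∀tʳ {A} t refl)      = ∀tʳ t (substPW-instT wkW t A)
  RightStep-↑w (∀wʳ {A} v refl)      = ∀wʳ (substW wkW v) (substPW-instW wkW v A)

  invertR : ∀ {m k} {Γ Δ : List (Jdg m k)} {P L Q} → RightStep P L Q → Γ ⨾ Δ ⟹ P → Γ ⨾ L ++ Δ ⟹ Q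
  invertR &ʳ₁ (&R d e) = d
  invertR &ʳ₂ (&R d e) = e
  invertR ⊸ʳ  (⊸R d)   = d
  invertR atʳ (atR d)  = d
  invertR (↓ʳ refl) (↓R d)     = d
  invertR (∀tʳ t refl) (∀tR d) = ∀tR-instance t d
  invertR (∀wʳ v refl) (∀wR d) = ∀wR-instance v d
  invertR {L = L} r (copy x d)  = copy x (exchange (shift _ L _) (invertR r d))
  invertR {L = L} r (⊗L q d)    = ⊗L (↭-prefix L q) (exchange (shift₂ L) (invertR r d))
  invertR {L = L} r (𝟏L q d)    = 𝟏L (↭-prefix L q) (invertR r d)
  invertR {L = L} r (⊸L {Δ₁ = Δ₁} q d e) =
    ⊸L (↭-trans (↭-prefix L q) (prep _ (shifts L Δ₁))) d (exchange (shift _ L _) (invertR r e))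
  invertR {L = L} r (&L₁ q d)   = &L₁ (↭-prefix L q) (exchange (shift _ L _) (invertR r d))
  invertR {L = L} r (&L₂ q d)   = &L₂ (↭-prefix L q) (exchange (shift _ L _) (invertR r d))
  invertR {L = L} r (⊕L q d e)  =
    ⊕L (↭-prefix L q) (exchange (shift _ L _) (invertR r d)) (exchange (shift _ L _) (invertR r e))
  invertR {L = L} r (𝟎L q)      = 𝟎L (↭-prefix L q)
  invertR {L = L} r (∀tL t q d) = ∀tL t (↭-prefix L q) (exchange (shift _ L _) (invertR r d))
  invertR {L = L} r (∀wL v q d) = ∀wL v (↭-prefix L q) (exchange (shift _ L _) (invertR r d))
  invertR {L = L} r (∃tL q d)   = ∃tL (↭-prefix L q) (reassemble-↑t {G = []} (invertR (RightStep-↑t r) d))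
  invertR {L = L} r (∃wL q d)   = ∃wL (↭-prefix L q) (reassemble-↑w {G = []} (invertR (RightStep-↑w r) d))
  invertR {L = L} r (!L q d)    = !L (↭-prefix L q) (invertR r d)
  invertR {L = L} r (atL q d)   = atL (↭-prefix L q) (exchange (shift _ L _) (invertR r d))
  invertR {L = L} r (↓L q d)    = ↓L (↭-prefix L q) (exchange (shift _ L _) (invertR r d))

module LeftInversion {c ℓ : Level} (𝒲 : Monoid c ℓ) (Sig : Signature) where
  open HyLL 𝒲 Sig
  open Substitution 𝒲 Sig
  open Structural 𝒲 Sig

  -- LeftStep P L G: the left rule with principal judgement P has a premise
  -- in which P is replaced by L in the linear context and G is added to the
  -- unrestricted context.  As for RightStep, the quantifier case allows any
  -- instance, given up to equality.
  data LeftStep {m k} : Jdg m k → List (Jdg m k) → List (Jdg m k) → Set c where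
    ⊗ˡ  : ∀ {A B u} → LeftStep (A ⊗ B ＠ u) ((A ＠ u) ∷ (B ＠ u) ∷ []) []
    𝟏ˡ  : ∀ {u} → LeftStep (`𝟏 ＠ u) [] []
    ⊕ˡ₁ : ∀ {A B u} → LeftStep (A ⊕ B ＠ u) [ A ＠ u ] []
    ⊕ˡ₂ : ∀ {A B u} → LeftStep (A ⊕ B ＠ u) [ B ＠ u ] []
    !ˡ  : ∀ {A u} → LeftStep (`! A ＠ u) [] [ A ＠ u ]
    atˡ : ∀ {A u v} → LeftStep ((A at u) ＠ v) [ A ＠ u ] []
    ↓ˡ  : ∀ {A v X} → X ≡ [ v /u] A → LeftStep (`↓ A ＠ v) [ X ＠ v ] []
    ∃tˡ : ∀ {A u X} (t : Term m) → X ≡ [ t /x] A → LeftStep (`∃t A ＠ u) [ X ＠ u ] []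
    ∃wˡ : ∀ {A u X} (v : World k) → X ≡ [ v /u] A → LeftStep (`∃w A ＠ u) [ X ＠ u ] []

  -- Left steps are stable under weakening by a fresh variable of either
  -- sort; this lets invertL pass under ∀R and ∃L.
  LeftStep-↑t : ∀ {m k} {P : Jdg m k} {L G} → LeftStep P L G → LeftStep (↑tJ P) (↑t* L) (↑t* G)
  LeftStep-↑t ⊗ˡ  = ⊗ˡ
  LeftStep-↑t 𝟏ˡ  = 𝟏ˡ
  LeftStep-↑t ⊕ˡ₁ = ⊕ˡ₁
  LeftStep-↑t ⊕ˡ₂ = ⊕ˡ₂
  LeftStep-↑t !ˡ  = !ˡ
  LeftStep-↑t atˡ = atˡ
  LeftStep-↑t (↓ˡ {A} {v} refl) = ↓ˡ (substPT-instW wkT v A)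
  LeftStep-↑t (∃tˡ {A} t refl)  = ∃tˡ (substT wkT t) (substPT-instT wkT t A)
  LeftStep-↑t (∃wˡ {A} v refl)  = ∃wˡ v (substPT-instW wkT v A)

  LeftStep-↑w : ∀ {m k} {P : Jdg m k} {L G} → LeftStep P L G → LeftStep (↑wJ P) (↑w* L) (↑w* G)
  LeftStep-↑w ⊗ˡ  = ⊗ˡ
  LeftStep-↑w 𝟏ˡ  = 𝟏ˡ
  LeftStep-↑w ⊕ˡ₁ = ⊕ˡ₁
  LeftStep-↑w ⊕ˡ₂ = ⊕ˡ₂
  LeftStep-↑w !ˡ  = !ˡ
  LeftStep-↑w atˡ = atˡ
  LeftStep-↑w (↓ˡ {A} {v} refl) = ↓ˡ (substPW-instW wkW v A)
  LeftStep-↑w (∃tˡ {A} t refl)  = ∃tˡ t (substPW-instT wkW t A)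
  LeftStep-↑w (∃wˡ {A} v refl)  = ∃wˡ (substW wkW v) (substPW-instW wkW v A)

  compare-principal : ∀ {m k} {Δ' Δ Δ₀ : List (Jdg m k)} {P Q} → Δ' ↭ P ∷ Δ → Δ' ↭ Q ∷ Δ₀ →
    (P ≡ Q × Δ ↭ Δ₀) ⊎ Σ (List (Jdg m k)) (λ R → (Δ₀ ↭ P ∷ R) × (Δ ↭ Q ∷ R))
  compare-principal p q = ↭-∷-cases (↭-trans (↭-sym p) q)

  -- If a sequent whose linear context contains P is derivable, so is the
  -- sequent obtained by a left step on P.  By induction on the derivation,
  -- locating P in the context of the last rule: if P is principal, the rule
  -- is the one of the step (left rules not inverted here have no LeftStep),
  -- otherwise the rule commutes with the inversion.
  invertL : ∀ {m k} {Γ Δ' Δ : List (Jdg m k)} {J P L G} →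
    LeftStep P L G → Γ ⨾ Δ' ⟹ J → Δ' ↭ P ∷ Δ → G ++ Γ ⨾ L ++ Δ ⟹ J
  invertL r init p with ∈-resp-↭ (↭-sym p) (here refl)
  invertL () init p | here refl
  invertL r  init p | there ()
  invertL {L = L} {G} r (copy x d) p =
    copy (∈-++⁺ʳ G x) (exchange (shift _ L _) (invertL r d (↭-under₁ p)))
  invertL {Δ = Δ} {L = L} {G} r (⊗R {Δ₁ = Δ₁} {Δ₂} q d e) p with ↭-++-cases Δ₁ Δ₂ (↭-trans (↭-sym p) q)
  ... | inj₁ (R , a , b) =
    ⊗R (↭-trans (++⁺ˡ L b) (↭-reflexive (sym (++-assoc L R Δ₂)))) (invertL r d a) (weaken-prefix G e)
  ... | inj₂ (R , a , b) =
    ⊗R (↭-trans (++⁺ˡ L b) (shifts L Δ₁)) (weaken-prefix G d) (invertL r e a)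
  invertL r (⊗L q d) p with compare-principal p q
  invertL ⊗ˡ (⊗L q d) p | inj₁ (refl , b) = exchange (prep _ (prep _ (↭-sym b))) d
  invertL {L = L} r (⊗L q d) p | inj₂ (R , a , b) =
    ⊗L (↭-prefix L b) (exchange (shift₂ L) (invertL r d (↭-under₂ a)))
  invertL r 𝟏R p = ⊥-elim (¬x∷xs↭[] (↭-sym p))
  invertL r (𝟏L q d) p with compare-principal p q
  invertL 𝟏ˡ (𝟏L q d) p | inj₁ (refl , b) = exchange (↭-sym b) d
  invertL {L = L} r (𝟏L q d) p | inj₂ (R , a , b) = 𝟏L (↭-prefix L b) (invertL r d a)
  invertL {L = L} r (⊸R d) p = ⊸R (exchange (shift _ L _) (invertL r d (↭-under₁ p)))
  invertL r (⊸L {Δ₁ = Δ₁} {Δ₂} q d e) p with compare-principal p q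
  invertL () (⊸L q d e) p | inj₁ (refl , b)
  invertL {L = L} {G} r (⊸L {Δ₁ = Δ₁} {Δ₂} q d e) p | inj₂ (R , a , b) with ↭-++-cases Δ₁ Δ₂ (↭-sym a)
  ... | inj₁ (R' , a₁ , b₁) =
    ⊸L (↭-trans (↭-prefix L b) (prep _ (↭-trans (++⁺ˡ L b₁) (↭-reflexive (sym (++-assoc L R' Δ₂))))))
       (invertL r d a₁) (weaken-prefix G e)
  ... | inj₂ (R' , a₂ , b₂) =
    ⊸L (↭-trans (↭-prefix L b) (prep _ (↭-trans (++⁺ˡ L b₂) (shifts L Δ₁))))
       (weaken-prefix G d) (exchange (shift _ L _) (invertL r e (↭-under₁ a₂)))
  invertL r ⊤R p = ⊤R
  invertL r (&R d e) p = &R (invertL r d p) (invertL r e p)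
  invertL r (&L₁ q d) p with compare-principal p q
  invertL () (&L₁ q d) p | inj₁ (refl , b)
  invertL {L = L} r (&L₁ q d) p | inj₂ (R , a , b) =
    &L₁ (↭-prefix L b) (exchange (shift _ L _) (invertL r d (↭-under₁ a)))
  invertL r (&L₂ q d) p with compare-principal p q
  invertL () (&L₂ q d) p | inj₁ (refl , b)
  invertL {L = L} r (&L₂ q d) p | inj₂ (R , a , b) =
    &L₂ (↭-prefix L b) (exchange (shift _ L _) (invertL r d (↭-under₁ a)))
  invertL r (⊕R₁ d) p = ⊕R₁ (invertL r d p)
  invertL r (⊕R₂ d) p = ⊕R₂ (invertL r d p)
  invertL r (⊕L q d e) p with compare-principal p q
  invertL ⊕ˡ₁ (⊕L q d e) p | inj₁ (refl , b) = exchange (prep _ (↭-sym b)) d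
  invertL ⊕ˡ₂ (⊕L q d e) p | inj₁ (refl , b) = exchange (prep _ (↭-sym b)) e
  invertL {L = L} r (⊕L q d e) p | inj₂ (R , a , b) =
    ⊕L (↭-prefix L b) (exchange (shift _ L _) (invertL r d (↭-under₁ a)))
                      (exchange (shift _ L _) (invertL r e (↭-under₁ a)))
  invertL r (𝟎L q) p with compare-principal p q
  invertL () (𝟎L q) p | inj₁ (refl , b)
  invertL {L = L} r (𝟎L q) p | inj₂ (R , a , b) = 𝟎L (↭-prefix L b)
  invertL {Γ = Γ} {Δ = Δ} {L = L} {G} r (∀tR d) p =
    ∀tR (cast (sym (map-++ ↑tJ G Γ)) (sym (map-++ ↑tJ L Δ)) refl (invertL (LeftStep-↑t r) d (map⁺ ↑tJ p)))
  invertL {Γ = Γ} {Δ = Δ} {L = L} {G} r (∀wR d) p =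
    ∀wR (cast (sym (map-++ ↑wJ G Γ)) (sym (map-++ ↑wJ L Δ)) refl (invertL (LeftStep-↑w r) d (map⁺ ↑wJ p)))
  invertL r (∀tL t q d) p with compare-principal p q
  invertL () (∀tL t q d) p | inj₁ (refl , b)
  invertL {L = L} r (∀tL t q d) p | inj₂ (R , a , b) =
    ∀tL t (↭-prefix L b) (exchange (shift _ L _) (invertL r d (↭-under₁ a)))
  invertL r (∀wL v q d) p with compare-principal p q
  invertL () (∀wL v q d) p | inj₁ (refl , b)
  invertL {L = L} r (∀wL v q d) p | inj₂ (R , a , b) =
    ∀wL v (↭-prefix L b) (exchange (shift _ L _) (invertL r d (↭-under₁ a)))
  invertL r (∃tR t d) p = ∃tR t (invertL r d p)
  invertL r (∃wR v d) p = ∃wR v (invertL r d p)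
  invertL r (∃tL q d) p with compare-principal p q
  invertL (∃tˡ t refl) (∃tL q d) p | inj₁ (refl , b) = ∃tL-instance t (exchange (prep _ (map⁺ ↑tJ (↭-sym b))) d)
  invertL {L = L} {G} r (∃tL q d) p | inj₂ (R , a , b) =
    ∃tL (↭-prefix L b) (reassemble-↑t {G = G} (invertL (LeftStep-↑t r) d (↭-under₁ (map⁺ ↑tJ a))))
  invertL r (∃wL q d) p with compare-principal p q
  invertL (∃wˡ v refl) (∃wL q d) p | inj₁ (refl , b) = ∃wL-instance v (exchange (prep _ (map⁺ ↑wJ (↭-sym b))) d)
  invertL {L = L} {G} r (∃wL q d) p | inj₂ (R , a , b) =
    ∃wL (↭-prefix L b) (reassemble-↑w {G = G} (invertL (LeftStep-↑w r) d (↭-under₁ (map⁺ ↑wJ a))))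
  invertL r (!R d) p = ⊥-elim (¬x∷xs↭[] (↭-sym p))
  invertL r (!L q d) p with compare-principal p q
  invertL !ˡ (!L q d) p | inj₁ (refl , b) = exchange (↭-sym b) d
  invertL {L = L} {G} r (!L q d) p | inj₂ (R , a , b) =
    !L (↭-prefix L b) (weakenΓ (∈-resp-↭ (shift _ G _)) (invertL r d a))
  invertL r (atR d) p = atR (invertL r d p)
  invertL r (atL q d) p with compare-principal p q
  invertL atˡ (atL q d) p | inj₁ (refl , b) = exchange (prep _ (↭-sym b)) d
  invertL {L = L} r (atL q d) p | inj₂ (R , a , b) =
    atL (↭-prefix L b) (exchange (shift _ L _) (invertL r d (↭-under₁ a)))
  invertL r (↓R d) p = ↓R (invertL r d p)
  invertL r (↓L q d) p with compare-principal p q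
  invertL (↓ˡ refl) (↓L q d) p | inj₁ (refl , b) = exchange (prep _ (↭-sym b)) d
  invertL {L = L} r (↓L q d) p | inj₂ (R , a , b) =
    ↓L (↭-prefix L b) (exchange (shift _ L _) (invertL r d (↭-under₁ a)))

-- For ∀R and ∃L the derivation is first
-- weakened by a fresh variable and then inverted to the instance at that
-- variable, which is A itself (instT-fresh, instW-fresh).
module Inversions {c ℓ : Level} (𝒲 : Monoid c ℓ) (Sig : Signature) where
  open HyLL 𝒲 Sig
  open Substitution 𝒲 Sig
  open Structural 𝒲 Sig
  open RightInversion 𝒲 Sig
  open LeftInversion 𝒲 Sig

  inv-&R : Inv-&R
  inv-&R Γ Δ A B w d = invertR &ʳ₁ d , invertR &ʳ₂ d

  inv-⊤R : Inv-⊤R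
  inv-⊤R Γ Δ w d = tt

  inv-⊸R : Inv-⊸R
  inv-⊸R Γ Δ A B w d = invertR ⊸ʳ d

  inv-∀tR : Inv-∀tR
  inv-∀tR Γ Δ A w d = invertR (∀tʳ (var zero) (instT-fresh A)) (weakenT d)

  inv-∀wR : Inv-∀wR
  inv-∀wR Γ Δ A w d = invertR (∀wʳ (wvar zero) (instW-fresh A)) (weakenW d)

  inv-↓R : Inv-↓R
  inv-↓R Γ Δ A w d = invertR (↓ʳ refl) d

  inv-atR : Inv-atR
  inv-atR Γ Δ A u v d = invertR atʳ d

  inv-⊗L : Inv-⊗L
  inv-⊗L Γ Δ A B u J d = invertL ⊗ˡ d ↭-refl

  inv-𝟏L : Inv-𝟏L
  inv-𝟏L Γ Δ u J d = invertL 𝟏ˡ d ↭-refl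

  inv-⊕L : Inv-⊕L
  inv-⊕L Γ Δ A B u J d = invertL ⊕ˡ₁ d ↭-refl , invertL ⊕ˡ₂ d ↭-refl

  inv-𝟎L : Inv-𝟎L
  inv-𝟎L Γ Δ u J d = tt

  inv-∃tL : Inv-∃tL
  inv-∃tL Γ Δ A u J d = invertL (∃tˡ (var zero) (instT-fresh A)) (weakenT d) ↭-refl

  inv-∃wL : Inv-∃wL
  inv-∃wL Γ Δ A u J d = invertL (∃wˡ (wvar zero) (instW-fresh A)) (weakenW d) ↭-refl

  inv-!L : Inv-!L
  inv-!L Γ Δ A u J d = invertL !ˡ d ↭-refl

  inv-↓L : Inv-↓L
  inv-↓L Γ Δ A v J d = invertL (↓ˡ refl) d ↭-refl

  inv-atL : Inv-atL
  inv-atL Γ Δ A u v J d = invertL atˡ d ↭-refl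

mainTheorem6 : ∀ {c ℓ : Level} (𝒲 : Monoid c ℓ) (Sig : Signature) → HyLL.Theorem6 𝒲 Sig
mainTheorem6 𝒲 Sig =
  (inv-&R , inv-⊤R , inv-⊸R , inv-∀tR , inv-∀wR , inv-↓R , inv-atR) ,
  (inv-⊗L , inv-𝟏L , inv-⊕L , inv-𝟎L , inv-∃tL , inv-∃wL , inv-!L , inv-↓L , inv-atL)
  where open Inversions 𝒲 Sig
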